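{- Let $k\ge 2$ be an integer and let $G$ be a finite simple graph. Then $\chi_c(G)<k$ if and only if $G$ admits an $\mathcal{H}_{k+1}$-free circular ordering.
   Context: A circular ordering of a finite set $X$ is a ternary relation $C\subseteq X^3$ such that for all $x,y,z,w\in X$: $(x,y,z)\in C\Rightarrow(y,z,x)\in C$; $(x,y,z)\in C\Rightarrow(x,z,y)\notin C$; $(x,y,z),(x,z,w)\in C\Rightarrow(x,y,w)\in C$; and for distinct $x,y,z$ either $(x,y,z)\in C$ or $(x,z,y)\in C$ (points on a circle read clockwise). A circularly ordered graph is a pair $(G,C)$ with $C$ a circular ordering of $V(G)$; $(H,D)$ is an induced circularly ordered subgraph of $(G,C)$ if $H$ is an induced subgraph of $G$ and $D$ is the restriction of $C$; isomorphisms are graph isomorphisms preserving the ternary relation. For $n\ge 2$, write $SP_n\to(G,C)$ if there exist vertices $u_1,\dots,u_n$ of $G$ with $u_iu_{i+1}\in E(G)$ for $1\le i\le n-1$, $u_1,\dots,u_{n-1}$ pairwise distinct with $(u_1,u_i,u_j)\in C$ whenever $1<i<j\le n-1$, and either $u_n=u_1$ or ($u_n\notin\{u_1,\dots,u_{n-1}\}$ and $(u_{n-1},u_n,u_1)\in C$). $\mathcal{H}_n$ is the set (up to isomorphism) of circularly ordered graphs $X$ with $SP_n\to X$ but $SP_n\not\to Y$ for every proper induced circularly ordered subgraph $Y$ of $X$. A circular ordering $C$ of $V(G)$ is $\mathcal{H}_n$-free if $(G,C)$ has no induced circularly ordered subgraph isomorphic to a member of $\mathcal{H}_n$. For positive integers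 $q\le p$, $K_{p/q}$ is the graph on $\{0,\dots,p-1\}$ with $ij\in E$ iff $\min(|i-j|,p-|i-j|)\ge q$; $\chi_c(G)=\inf\{p/q: q\le p\le|V(G)|,\ G\to K_{p/q}\}$ ($\to$ = graph homomorphism exists). -}

module Defs where

open import Data.Nat using (ℕ; zero; suc; _∸_; _≤_; _<_; ∣_-_∣; _⊓_)
open import Data.Fin using (Fin; toℕ)
open import Data.Bool using (Bool; true; false)
open import Data.Product using (Σ; ∃; _×_; _,_)
open import Data.Sum using (_⊎_)
open import Relation.Binary.PropositionalEquality using (_≡_; _≢_; refl; cong)
open import Relation.Nullary using (¬_)
open import Function.Definitions using (Injective)
open import Data.Integer using (+_)
open import Data.Rational.Unnormalised using (ℚᵘ; _/_) renaming (_≤_ to _≤ℚ_)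

record Graph (n : ℕ) : Set where
  field
    adj        : Fin n → Fin n → Bool
    adj-sym    : ∀ i j → adj i j ≡ adj j i
    adj-irrefl : ∀ i → adj i i ≡ false

record IsCircularOrdering {n : ℕ} (C : Fin n → Fin n → Fin n → Bool) : Set where
  field
    cyclic : ∀ x y z → C x y z ≡ true → C y z x ≡ true
    asym   : ∀ x y z → C x y z ≡ true → C x z y ≡ false
    trans  : ∀ x y z w → C x y z ≡ true → C x z w ≡ true → C x y w ≡ true
    total  : ∀ x y z → x ≢ y → y ≢ z → x ≢ z → C x y z ≡ true ⊎ C x z y ≡ true

record COGraph (n : ℕ) : Set where
  field
    graph : Graph n
    cord  : Fin n → Fin n → Fin n → Bool
    isCO  : IsCircularOrdering cord

Edge : ∀ {n} → COGraph n → Fin n → Fin n → Set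
Edge X i j = Graph.adj (COGraph.graph X) i j ≡ true

Cyc : ∀ {n} → COGraph n → Fin n → Fin n → Fin n → Set
Cyc X x y z = COGraph.cord X x y z ≡ true

-- SP_n → X.  The vertices u_1,…,u_n are given by u : ℕ → V (1-based;
-- values outside 1..n are irrelevant).

SP→ : ℕ → ∀ {m} → COGraph m → Set
SP→ n {m} X = Σ (ℕ → Fin m) λ u →
    (∀ i → 1 ≤ i → i ≤ n ∸ 1 → Edge X (u i) (u (suc i)))
  × (∀ i j → 1 ≤ i → i < j → j ≤ n ∸ 1 → u i ≢ u j)
  × (∀ i j → 1 < i → i < j → j ≤ n ∸ 1 → Cyc X (u 1) (u i) (u j))
  × (  u n ≡ u 1
     ⊎ ((∀ i → 1 ≤ i → i ≤ n ∸ 1 → u n ≢ u i) × Cyc X (u (n ∸ 1)) (u n) (u 1)))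

restrict : ∀ {n k} (X : COGraph n) (f : Fin k → Fin n) → Injective _≡_ _≡_ f → COGraph k
restrict {n} {k} X f inj = record
  { graph = record
      { adj        = λ i j → Graph.adj G (f i) (f j)
      ; adj-sym    = λ i j → Graph.adj-sym G (f i) (f j)
      ; adj-irrefl = λ i → Graph.adj-irrefl G (f i)
      }
  ; cord = λ x y z → C (f x) (f y) (f z)
  ; isCO = record
      { cyclic = λ x y z → IsCircularOrdering.cyclic co (f x) (f y) (f z)
      ; asym   = λ x y z → IsCircularOrdering.asym co (f x) (f y) (f z)
      ; trans  = λ x y z w → IsCircularOrdering.trans co (f x) (f y) (f z) (f w)
      ; total  = λ x y z p q r → IsCircularOrdering.total co (f x) (f y) (f z)
                   (λ e → p (inj e)) (λ e → q (inj e)) (λ e → r (inj e))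
      }
  }
  where
    G  = COGraph.graph X
    C  = COGraph.cord X
    co = COGraph.isCO X

record _≅_ {a b : ℕ} (X : COGraph a) (Y : COGraph b) : Set where
  field
    to         : Fin a → Fin b
    from       : Fin b → Fin a
    from∘to    : ∀ i → from (to i) ≡ i
    to∘from    : ∀ j → to (from j) ≡ j
    adj-pres   : ∀ i j → Graph.adj (COGraph.graph X) i j
                         ≡ Graph.adj (COGraph.graph Y) (to i) (to j)
    cord-pres  : ∀ i j l → COGraph.cord X i j l ≡ COGraph.cord Y (to i) (to j) (to l)

InH : ℕ → ∀ {m} → COGraph m → Set
InH n {m} X =
    SP→ n X
  × (∀ k (f : Fin k → Fin m) (inj : Injective _≡_ _≡_ f) →
       (∃ λ v → ∀ i → f i ≢ v) → ¬ SP→ n (restrict X f inj))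

HFree : ℕ → ∀ {m} → COGraph m → Set
HFree n {m} X =
  ∀ k (f : Fin k → Fin m) (inj : Injective _≡_ _≡_ f) →
  ∀ l (Y : COGraph l) → InH n Y → ¬ (restrict X f inj ≅ Y)

AdmitsHFree : ℕ → ∀ {m} → Graph m → Set
AdmitsHFree n {m} G =
  Σ (Fin m → Fin m → Fin m → Bool) λ C →
  Σ (IsCircularOrdering C) λ isC →
  HFree n (record { graph = G ; cord = C ; isCO = isC })

KAdj : (p q : ℕ) → Fin p → Fin p → Set
KAdj p q i j = q ≤ (∣ toℕ i - toℕ j ∣ ⊓ (p ∸ ∣ toℕ i - toℕ j ∣))

Hom→K : ∀ {n} → Graph n → (p q : ℕ) → Set
Hom→K {n} G p q = Σ (Fin n → Fin p) λ c →
  ∀ u v → Graph.adj G u v ≡ true → KAdj p q (c u) (c v)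

-- the ratio p/q (with q = suc q') ranges over this set in the
-- definition of χ_c: q ≤ p ≤ |V(G)| and G → K_{p/q}
Admissible : ∀ {n} → Graph n → (p q' : ℕ) → Set
Admissible {n} G p q' = suc q' ≤ p × p ≤ n × Hom→K G p (suc q')

IsLowerBound : ∀ {n} → Graph n → ℚᵘ → Set
IsLowerBound G r = ∀ p q' → Admissible G p q' → r ≤ℚ ((+ p) / suc q')

IsChiC : ∀ {n} → Graph n → ℚᵘ → Set
IsChiC G r = IsLowerBound G r × (∀ s → IsLowerBound G s → s ≤ℚ r)

-- If G → K_{p/q} with p < kq, order the vertices circularly by colour.  Along a special path
-- u₁ … u_k, colours unrolled from c(u₁) rise by at least q per edge without passing c(u₁) + p,
-- and closing the path needs q more, so kq ≤ p: no SP_{k+1} occurs.  Every member of ℋ_{k+1}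
-- admits SP_{k+1}, so such an ordering is ℋ_{k+1}-free; conversely, a minimal induced subgraph
-- admitting SP_{k+1} lies in ℋ_{k+1}.
--
-- Given an ordering without SP_{k+1}, cut it open into a linear order.  Increasing walks along
-- edges then have fewer than k edges, so their lengths give levels 0 … k − 1 increasing along
-- forward edges.  Tight edges, raising the level by one or wrapping from k − 1 to 0, admit no long
-- walks either, because k consecutive ones wind once around the circle; so some potential g
-- increases along them, and v ↦ level(v)·N + g(v) maps G into K_{P/N} with P = kN − 1.  The
-- numerator is then brought down to at most |V(G)|: divide by gcd(P, N) or, when P and N are
-- coprime and some colour is unused, rotate it to P − 1 and apply a ↦ ⌊(a + 1)p/P⌋ for the Farey
-- neighbour p/q of P/N.  As χ_c(G) is the least of these finitely many ratios, both directions
-- read χ_c(G) < k.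

module Submission where

open import Defs

module CircularColourings where

  open import Data.Nat
    using (ℕ; zero; suc; z≤n; s≤s; s≤s⁻¹; _∸_; _+_; _*_; _⊓_; ∣_-_∣; _≤_; _<_; _≤?_; _<?_; NonZero; >-nonZero)
  open import Data.Nat.Properties
  open import Data.Nat.DivMod
  open import Data.Nat.Divisibility using (_∣_; divides; ∣m+n∣m⇒∣n; ∣⇒≤; n∣m*n; ∣-refl; 0∣⇒≡0)
  open import Data.Nat.GCD using (module Bézout; module GCD)
  open import Data.Nat.Induction using (<-rec)
  open import Data.Nat.Tactic.RingSolver using (solve-∀)
  open import Algebra.Properties.CommutativeSemigroup +-commutativeSemigroup
    using () renaming (xy∙z≈xz∙y to m+n+o≡m+o+n)
  open import Data.Fin using (Fin; toℕ; fromℕ<)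
  import Data.Fin as F
  import Data.Fin.Properties as Finₚ
  open import Data.Vec.Functional using (_∷_)
  import Data.Integer as ℤ
  import Data.Integer.Properties as ℤₚ
  open import Data.Rational.Unnormalised using (*<*; *≤*)
  import Data.Rational.Unnormalised as ℚᵘ
  open import Data.Bool using (Bool; true; false)
  import Data.Bool.Properties as Boolₚ
  open import Data.Product using (Σ; ∃; ∃₂; _×_; _,_; proj₁; proj₂)
  open import Data.Sum using (_⊎_; inj₁; inj₂)
  import Data.Sum
  open import Data.Empty using (⊥; ⊥-elim)
  open import Function using (_∘_; _∘₂_)
  open import Function.Definitions using (Injective)
  open import Relation.Nullary using (¬_; Dec; yes; no; does; contradiction)
  open import Relation.Nullary.Decidable
    using (map′; dec-true; dec-false; _×-dec_; _⊎-dec_; _→-dec_; ¬?; ¬¬-excluded-middle; decidable-stable)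
  open import Relation.Binary.Definitions using (tri<; tri≈; tri>)
  open import Relation.Binary.PropositionalEquality

  FarApart : (p q a b : ℕ) → Set
  FarApart p q a b = q ≤ ∣ a - b ∣ ⊓ (p ∸ ∣ a - b ∣)

  farApart-sym : ∀ {p q a b} → FarApart p q a b → FarApart p q b a
  farApart-sym {p} {q} {a} {b} h rewrite ∣-∣-comm b a = h

  farApart-intro : ∀ {p q a b} → q + a ≤ b → b + q ≤ a + p → FarApart p q a b
  farApart-intro {p} {q} {a} {b} lower upper rewrite m≤n⇒∣m-n∣≡n∸m (m+n≤o⇒n≤o q lower) =
    ⊓-glb (m+n≤o⇒m≤o∸n q lower) (m+n≤o⇒m≤o∸n q (+-cancelʳ-≤ a _ _ q+[b∸a]+a≤p+a))
    where
    a≤b : a ≤ b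
    a≤b = m+n≤o⇒n≤o q lower
    open ≤-Reasoning
    q+[b∸a]+a≤p+a : q + (b ∸ a) + a ≤ p + a
    q+[b∸a]+a≤p+a = begin
      q + (b ∸ a) + a ≡⟨ +-assoc q (b ∸ a) a ⟩
      q + (b ∸ a + a) ≡⟨ cong (q +_) (m∸n+n≡m a≤b) ⟩
      q + b           ≡⟨ +-comm q b ⟩
      b + q           ≤⟨ upper ⟩
      a + p           ≡⟨ +-comm a p ⟩
      p + a           ∎

  farApart-elim : ∀ {p q a b} → 1 ≤ q → FarApart p q a b → a ≤ b → q + a ≤ b × b + q ≤ a + p
  farApart-elim {p} {q} {a} {b} 1≤q h a≤b rewrite m≤n⇒∣m-n∣≡n∸m a≤b =
    subst (q + a ≤_) (m∸n+n≡m a≤b) (+-monoˡ-≤ a q≤d) , upper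
    where
    d : ℕ
    d = b ∸ a
    q≤d : q ≤ d
    q≤d = ≤-trans h (m⊓n≤m d (p ∸ d))
    q≤p∸d : q ≤ p ∸ d
    q≤p∸d = ≤-trans h (m⊓n≤n d (p ∸ d))
    d≤p : d ≤ p
    d≤p = ≮⇒≥ λ p<d → <⇒≱ 1≤q (subst (q ≤_) (m≤n⇒m∸n≡0 (<⇒≤ p<d)) q≤p∸d)
    open ≤-Reasoning
    upper : b + q ≤ a + p
    upper = begin
      b + q       ≡⟨ cong (_+ q) (sym (m+[n∸m]≡n a≤b)) ⟩
      a + d + q   ≡⟨ +-assoc a d q ⟩
      a + (d + q) ≡⟨ cong (a +_) (+-comm d q) ⟩
      a + (q + d) ≤⟨ +-monoʳ-≤ a (m≤o∸n⇒m+n≤o q d≤p q≤p∸d) ⟩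
      a + p       ∎

  farApart-wlog : ∀ {p q p′ q′} (f : ℕ → ℕ) →
                  (∀ {a b} → a ≤ b → FarApart p q a b → FarApart p′ q′ (f a) (f b)) →
                  ∀ {a b} → FarApart p q a b → FarApart p′ q′ (f a) (f b)
  farApart-wlog {p} {q} {p′} {q′} f ordered {a} {b} far with ≤-total a b
  ... | inj₁ a≤b = ordered a≤b far
  ... | inj₂ b≤a = farApart-sym {p′} {q′} {f b} (ordered b≤a (farApart-sym {p} {q} {a} far))

  hom→K-fromℕ : ∀ {n P Q} (G : Graph n) (f : Fin n → ℕ) (f<P : ∀ v → f v < P) →
                (∀ u v → Graph.adj G u v ≡ true → FarApart P Q (f u) (f v)) → Hom→K G P Q
  hom→K-fromℕ {P = P} {Q} G f f<P far = (λ v → fromℕ< (f<P v)) , λ u v uv →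
    subst₂ (FarApart P Q) (sym (Finₚ.toℕ-fromℕ< (f<P u))) (sym (Finₚ.toℕ-fromℕ< (f<P v))) (far u v uv)

  AdmissibleBelow : ℕ → ∀ {n} → Graph n → Set
  AdmissibleBelow k G = ∃₂ λ p q′ → Admissible G p q′ × p < k * suc q′

  CyclicallyOrdered : ℕ → ℕ → ℕ → Set
  CyclicallyOrdered a b c = (a < b × b < c) ⊎ (b < c × c < a) ⊎ (c < a × a < b)

  cyclicallyOrdered? : ∀ a b c → Dec (CyclicallyOrdered a b c)
  cyclicallyOrdered? a b c =
    ((a <? b) ×-dec (b <? c)) ⊎-dec ((b <? c) ×-dec (c <? a)) ⊎-dec ((c <? a) ×-dec (a <? b))

  cyclicallyOrdered-rotate : ∀ {a b c} → CyclicallyOrdered a b c → CyclicallyOrdered b c a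
  cyclicallyOrdered-rotate (inj₁ h)        = inj₂ (inj₂ h)
  cyclicallyOrdered-rotate (inj₂ (inj₁ h)) = inj₁ h
  cyclicallyOrdered-rotate (inj₂ (inj₂ h)) = inj₂ (inj₁ h)

  cyclicallyOrdered-asym : ∀ {a b c} → CyclicallyOrdered a b c → ¬ CyclicallyOrdered a c b
  cyclicallyOrdered-asym (inj₁ (_ , b<c))        (inj₁ (_ , c<b))        = <-asym b<c c<b
  cyclicallyOrdered-asym (inj₁ (_ , b<c))        (inj₂ (inj₁ (c<b , _))) = <-asym b<c c<b
  cyclicallyOrdered-asym (inj₁ (a<b , _))        (inj₂ (inj₂ (b<a , _))) = <-asym a<b b<a
  cyclicallyOrdered-asym (inj₂ (inj₁ (_ , c<a))) (inj₁ (a<c , _))        = <-asym c<a a<c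
  cyclicallyOrdered-asym (inj₂ (inj₁ (b<c , _))) (inj₂ (inj₁ (c<b , _))) = <-asym b<c c<b
  cyclicallyOrdered-asym (inj₂ (inj₁ (_ , c<a))) (inj₂ (inj₂ (_ , a<c))) = <-asym c<a a<c
  cyclicallyOrdered-asym (inj₂ (inj₂ (c<a , _))) (inj₁ (a<c , _))        = <-asym c<a a<c
  cyclicallyOrdered-asym (inj₂ (inj₂ (_ , a<b))) (inj₂ (inj₁ (_ , b<a))) = <-asym a<b b<a
  cyclicallyOrdered-asym (inj₂ (inj₂ (_ , a<b))) (inj₂ (inj₂ (b<a , _))) = <-asym a<b b<a

  cyclicallyOrdered-trans : ∀ {a b c d} → CyclicallyOrdered a b c → CyclicallyOrdered a c d →
                            CyclicallyOrdered a b d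
  cyclicallyOrdered-trans (inj₁ (a<b , b<c)) (inj₁ (_ , c<d))        = inj₁ (a<b , <-trans b<c c<d)
  cyclicallyOrdered-trans (inj₁ (a<b , b<c)) (inj₂ (inj₁ (c<d , d<a))) =
    ⊥-elim (<-asym (<-trans a<b b<c) (<-trans c<d d<a))
  cyclicallyOrdered-trans (inj₁ (a<b , _))   (inj₂ (inj₂ (d<a , _)))  = inj₂ (inj₂ (d<a , a<b))
  cyclicallyOrdered-trans (inj₂ (inj₁ (_ , c<a))) (inj₁ (a<c , _))    = ⊥-elim (<-asym c<a a<c)
  cyclicallyOrdered-trans (inj₂ (inj₁ (b<c , _))) (inj₂ (inj₁ (c<d , d<a))) =
    inj₂ (inj₁ (<-trans b<c c<d , d<a))
  cyclicallyOrdered-trans (inj₂ (inj₁ (_ , c<a))) (inj₂ (inj₂ (_ , a<c))) = ⊥-elim (<-asym c<a a<c)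
  cyclicallyOrdered-trans (inj₂ (inj₂ (c<a , _))) (inj₁ (a<c , _))        = ⊥-elim (<-asym c<a a<c)
  cyclicallyOrdered-trans (inj₂ (inj₂ (_ , a<b))) (inj₂ (inj₁ (_ , d<a))) = inj₂ (inj₂ (d<a , a<b))
  cyclicallyOrdered-trans (inj₂ (inj₂ (c<a , _))) (inj₂ (inj₂ (_ , a<c))) = ⊥-elim (<-asym c<a a<c)

  cyclicallyOrdered-total : ∀ a b c → a ≢ b → b ≢ c → a ≢ c →
                            CyclicallyOrdered a b c ⊎ CyclicallyOrdered a c b
  cyclicallyOrdered-total a b c a≢b b≢c a≢c with <-cmp a b | <-cmp b c | <-cmp a c
  ... | tri≈ _ a≡b _ | _            | _            = contradiction a≡b a≢b
  ... | _            | tri≈ _ b≡c _ | _            = contradiction b≡c b≢c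
  ... | _            | _            | tri≈ _ a≡c _ = contradiction a≡c a≢c
  ... | tri< a<b _ _ | tri< b<c _ _ | _            = inj₁ (inj₁ (a<b , b<c))
  ... | tri< _ _ _   | tri> _ _ c<b | tri< a<c _ _ = inj₂ (inj₁ (a<c , c<b))
  ... | tri< a<b _ _ | tri> _ _ _   | tri> _ _ c<a = inj₁ (inj₂ (inj₂ (c<a , a<b)))
  ... | tri> _ _ b<a | tri< _ _ _   | tri< a<c _ _ = inj₂ (inj₂ (inj₂ (b<a , a<c)))
  ... | tri> _ _ _   | tri< b<c _ _ | tri> _ _ c<a = inj₁ (inj₂ (inj₁ (b<c , c<a)))
  ... | tri> _ _ b<a | tri> _ _ c<b | _            = inj₂ (inj₂ (inj₁ (c<b , b<a)))

  keyOrder : ∀ {n} → (Fin n → ℕ) → Fin n → Fin n → Fin n → Bool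
  keyOrder κ x y z = does (cyclicallyOrdered? (κ x) (κ y) (κ z))

  keyOrder⇒cyclicallyOrdered : ∀ {n} (κ : Fin n → ℕ) {x y z} → keyOrder κ x y z ≡ true →
                               CyclicallyOrdered (κ x) (κ y) (κ z)
  keyOrder⇒cyclicallyOrdered κ {x} {y} {z} = witness (cyclicallyOrdered? (κ x) (κ y) (κ z))
    where
    witness : ∀ {A : Set} (a? : Dec A) → does a? ≡ true → A
    witness (yes a) _ = a
    witness (no _)  ()

  keyOrder-isCircularOrdering : ∀ {n} (κ : Fin n → ℕ) → Injective _≡_ _≡_ κ →
                                IsCircularOrdering (keyOrder κ)
  keyOrder-isCircularOrdering κ κ-inj = record
    { cyclic = λ x y z h →
        dec-true (cyclicallyOrdered? _ _ _) (cyclicallyOrdered-rotate (from h))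
    ; asym = λ x y z h →
        dec-false (cyclicallyOrdered? _ _ _) (cyclicallyOrdered-asym (from h))
    ; trans = λ x y z w h h′ →
        dec-true (cyclicallyOrdered? _ _ _) (cyclicallyOrdered-trans (from h) (from h′))
    ; total = λ x y z x≢y y≢z x≢z →
        Data.Sum.map (dec-true (cyclicallyOrdered? _ _ _)) (dec-true (cyclicallyOrdered? _ _ _))
          (cyclicallyOrdered-total _ _ _ (x≢y ∘ κ-inj) (y≢z ∘ κ-inj) (x≢z ∘ κ-inj))
    }
    where
    from : ∀ {x y z} → keyOrder κ x y z ≡ true → CyclicallyOrdered (κ x) (κ y) (κ z)
    from = keyOrder⇒cyclicallyOrdered κ

  -- ℋ-freeness is the absence of special paths

  ClosesUp : ∀ M {m} → COGraph m → (ℕ → Fin m) → Set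
  ClosesUp M X u = u M ≡ u 1 ⊎ ((∀ i → 1 ≤ i → i ≤ M ∸ 1 → u M ≢ u i) × Cyc X (u (M ∸ 1)) (u M) (u 1))

  SP→-map : ∀ M {a b} (X : COGraph a) (Y : COGraph b) (g : Fin a → Fin b) → Injective _≡_ _≡_ g →
            (∀ i j → Edge X i j → Edge Y (g i) (g j)) →
            (∀ i j l → Cyc X i j l → Cyc Y (g i) (g j) (g l)) →
            SP→ M X → SP→ M Y
  SP→-map M X Y g g-inj edge cyc (u , path , distinct , ordered , closing) =
    g ∘ u , (λ i 1≤i i≤ → edge _ _ (path i 1≤i i≤)) , (λ i j 1≤i i<j j≤ → distinct i j 1≤i i<j j≤ ∘ g-inj) ,
    (λ i j 1<i i<j j≤ → cyc _ _ _ (ordered i j 1<i i<j j≤)) , map-closing closing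
    where
    map-closing : ClosesUp M X u → ClosesUp M Y (g ∘ u)
    map-closing (inj₁ un≡u1)          = inj₁ (cong g un≡u1)
    map-closing (inj₂ (fresh , last)) = inj₂ ((λ i 1≤i i≤ → fresh i 1≤i i≤ ∘ g-inj) , cyc _ _ _ last)

  ≅-refl : ∀ {m} {X : COGraph m} → X ≅ X
  ≅-refl = record
    { to = λ i → i ; from = λ i → i ; from∘to = λ _ → refl ; to∘from = λ _ → refl
    ; adj-pres = λ _ _ → refl ; cord-pres = λ _ _ _ → refl }

  ¬SP→⇒HFree : ∀ M {m} (X : COGraph m) → ¬ SP→ M X → HFree M X
  ¬SP→⇒HFree M X ¬sp k f f-inj l Y (spY , _) Y≅X′ =
    ¬sp (SP→-map M X′ X f f-inj (λ _ _ e → e) (λ _ _ _ c → c)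
          (SP→-map M Y X′ from from-inj edge cyc spY))
    where
    open _≅_ Y≅X′ renaming (to∘from to inverse)
    X′ : COGraph k
    X′ = restrict X f f-inj
    from-inj : Injective _≡_ _≡_ from
    from-inj {i} {j} e = trans (sym (inverse i)) (trans (cong to e) (inverse j))
    edge : ∀ i j → Edge Y i j → Edge X′ (from i) (from j)
    edge i j e = trans (adj-pres (from i) (from j))
                   (trans (cong₂ (Graph.adj (COGraph.graph Y)) (inverse i) (inverse j)) e)
    cyc : ∀ i j l → Cyc Y i j l → Cyc X′ (from i) (from j) (from l)
    cyc i j l c = trans (cord-pres (from i) (from j) (from l))
                    (trans (cong₂ (λ a b → COGraph.cord Y a b (to (from l))) (inverse i) (inverse j))
                      (trans (cong (COGraph.cord Y i j) (inverse l)) c))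

  properEmbedding⇒< : ∀ {k m} (f : Fin k → Fin m) → Injective _≡_ _≡_ f →
                      (∃ λ v → ∀ i → f i ≢ v) → k < m
  properEmbedding⇒< {m = zero}  f _     (() , _)
  properEmbedding⇒< {m = suc m} f f-inj (v , missed) =
    s≤s (Finₚ.injective⇒≤ λ e → f-inj (Finₚ.punchOut-injective (avoids _) (avoids _) e))
    where
    avoids : ∀ i → v ≢ f i
    avoids i = missed i ∘ sym

  -- A minimal induced subgraph admitting SP_M lies in ℋ_M; as the goal is negative, excluded middle
  -- is available to decide whether a proper one admits SP_M.
  HFree⇒¬SP→ : ∀ M {m} (X : COGraph m) → HFree M X → ¬ SP→ M X
  HFree⇒¬SP→ M {m} X free = noInducedSP m (λ i → i) (λ e → e)
    where
    ProperSP : ∀ {k} (f : Fin k → Fin m) → Injective _≡_ _≡_ f → Set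
    ProperSP {k} f f-inj = ∃₂ λ k′ (g : Fin k′ → Fin k) → Σ (Injective _≡_ _≡_ g) λ g-inj →
      (∃ λ v → ∀ i → g i ≢ v) × SP→ M (restrict (restrict X f f-inj) g g-inj)
    NoInducedSP : ℕ → Set
    NoInducedSP k = ∀ (f : Fin k → Fin m) (f-inj : Injective _≡_ _≡_ f) → ¬ SP→ M (restrict X f f-inj)
    noInducedSP : ∀ k → NoInducedSP k
    noInducedSP = <-rec NoInducedSP λ k rec f f-inj sp → ¬¬-excluded-middle {A = ProperSP f f-inj} λ
      { (yes (k′ , g , g-inj , proper , sp′)) →
          rec (properEmbedding⇒< g g-inj proper) (f ∘ g) (g-inj ∘ f-inj) sp′
      ; (no minimal) →
          free k f f-inj k _ (sp , λ k′ g g-inj proper sp′ → minimal (k′ , g , g-inj , proper , sp′)) ≅-refl }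

  -- χ_c(G) < k gives an ℋ_{k+1}-free circular ordering

  *-+-lex< : ∀ {a b x y} n → x < n → a < b → a * n + x < b * n + y
  *-+-lex< {a} {b} {x} {y} n x<n a<b = begin-strict
    a * n + x  <⟨ +-monoʳ-< (a * n) x<n ⟩
    a * n + n  ≡⟨ +-comm (a * n) n ⟩
    suc a * n  ≤⟨ *-monoˡ-≤ n a<b ⟩
    b * n      ≤⟨ m≤m+n (b * n) y ⟩
    b * n + y  ∎
    where open ≤-Reasoning

  module ColourOrder (k : ℕ) {n : ℕ} (G : Graph n) (p q′ : ℕ) (c : Fin n → Fin p)
                     (hom : ∀ u v → Graph.adj G u v ≡ true → KAdj p (suc q′) (c u) (c v))
                     (p<kq : p < k * suc q′) where

    q : ℕ
    q = suc q′

    colour : Fin n → ℕ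
    colour = toℕ ∘ c

    rank : Fin n → ℕ
    rank v = colour v * n + toℕ v

    rank-monotone : ∀ {x y} → rank x < rank y → colour x ≤ colour y
    rank-monotone {x} {y} rx<ry =
      ≮⇒≥ λ cy<cx → <-asym rx<ry (*-+-lex< n (Finₚ.toℕ<n y) cy<cx)

    rank-injective : Injective _≡_ _≡_ rank
    rank-injective {x} {y} rx≡ry =
      Finₚ.toℕ-injective (+-cancelˡ-≡ (colour x * n) _ _ (trans rx≡ry (cong (λ t → t * n + toℕ y) (sym cx≡cy))))
      where
      cx≡cy : colour x ≡ colour y
      cx≡cy with <-cmp (colour x) (colour y)
      ... | tri< cx<cy _ _ = contradiction rx≡ry (<⇒≢ (*-+-lex< n (Finₚ.toℕ<n x) cx<cy))
      ... | tri≈ _ cx≡cy _ = cx≡cy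
      ... | tri> _ _ cy<cx = contradiction (sym rx≡ry) (<⇒≢ (*-+-lex< n (Finₚ.toℕ<n y) cy<cx))

    X : COGraph n
    X = record { graph = G ; cord = keyOrder rank ; isCO = keyOrder-isCircularOrdering rank rank-injective }

    forwardEdge : ∀ {x y} → Edge X x y → rank x < rank y → q + colour x ≤ colour y × colour y + q ≤ colour x + p
    forwardEdge {x} {y} xy rx<ry = farApart-elim (s≤s z≤n) (hom x y xy) (rank-monotone rx<ry)

    backwardEdge : ∀ {x y} → Edge X x y → rank y < rank x → q + colour y ≤ colour x × colour x + q ≤ colour y + p
    backwardEdge {x} {y} xy ry<rx = farApart-elim (s≤s z≤n) (farApart-sym {p} {q} {colour x} (hom x y xy)) (rank-monotone ry<rx)

    -- Colours unrolled onto the line starting at the colour of `base`, following the ordering.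
    module Unrolled (base : Fin n) where

      unroll : Fin n → ℕ
      unroll v with rank v <? rank base
      ... | yes _ = colour v + p
      ... | no  _ = colour v

      shift : ∀ {a b} → q + a ≤ b → a + q ≤ b
      shift {a} {b} = subst (_≤ b) (+-comm q a)

      shift+p : ∀ {a b} → q + a ≤ b → a + p + q ≤ b + p
      shift+p {a} {b} h = subst (_≤ b + p) (m+n+o≡m+o+n a q p) (+-monoˡ-≤ p (shift h))

      unroll-bounded : ∀ v → unroll v ≤ colour base + p
      unroll-bounded v with rank v <? rank base
      ... | yes rv<rb = +-monoˡ-≤ p (rank-monotone rv<rb)
      ... | no  _     = ≤-trans (<⇒≤ (Finₚ.toℕ<n (c v))) (m≤n+m p (colour base))

      unroll-step : ∀ x y → CyclicallyOrdered (rank base) (rank x) (rank y) → Edge X x y →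
                    unroll x + q ≤ unroll y
      unroll-step x y cyc xy with rank x <? rank base | rank y <? rank base
      unroll-step x y (inj₁ (rb<rx , _)) xy | yes rx<rb | _ = contradiction rb<rx (<-asym rx<rb)
      unroll-step x y (inj₁ (rb<rx , rx<ry)) xy | no _ | yes ry<rb = contradiction (<-trans rb<rx rx<ry) (<-asym ry<rb)
      unroll-step x y (inj₁ (_ , rx<ry)) xy | no _ | no _ = shift (proj₁ (forwardEdge xy rx<ry))
      unroll-step x y (inj₂ (inj₁ (rx<ry , _))) xy | yes _ | yes _ = shift+p (proj₁ (forwardEdge xy rx<ry))
      unroll-step x y (inj₂ (inj₁ (rx<ry , ry<rb))) xy | no rx≮rb | _ = contradiction (<-trans rx<ry ry<rb) rx≮rb
      unroll-step x y (inj₂ (inj₁ (_ , ry<rb))) xy | yes _ | no ry≮rb = contradiction ry<rb ry≮rb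
      unroll-step x y (inj₂ (inj₂ (_ , rb<rx))) xy | yes rx<rb | _ = contradiction rb<rx (<-asym rx<rb)
      unroll-step x y (inj₂ (inj₂ (ry<rb , _))) xy | no _ | no ry≮rb = contradiction ry<rb ry≮rb
      unroll-step x y (inj₂ (inj₂ (ry<rb , rb<rx))) xy | no _ | yes _ = proj₂ (backwardEdge xy (<-trans ry<rb rb<rx))

      unroll-fromBase : ∀ x → Edge X base x → colour base + q ≤ unroll x × unroll x + q ≤ colour base + p
      unroll-fromBase x bx with rank x <? rank base
      ... | yes rx<rb = proj₂ (backwardEdge bx rx<rb) , shift+p (proj₁ (backwardEdge bx rx<rb))
      ... | no rx≮rb = shift (proj₁ (forwardEdge bx rb<rx)) , proj₂ (forwardEdge bx rb<rx)
        where
        rb<rx : rank base < rank x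
        rb<rx with <-cmp (rank base) (rank x)
        ... | tri< rb<rx _ _ = rb<rx
        ... | tri≈ _ rb≡rx _ = contradiction (trans (sym (Graph.adj-irrefl G base))
                                                (subst (λ v → Edge X base v) (sym (rank-injective rb≡rx)) bx)) λ ()
        ... | tri> _ _ rx<rb = contradiction rx<rb rx≮rb

    noSP : 2 ≤ k → ¬ SP→ (suc k) X
    noSP 2≤k (u , path , _ , ordered , closing) = <⇒≱ p<kq (+-cancelˡ-≤ (colour (u 1)) _ _ (begin
      colour (u 1) + k * q             ≡⟨ cong (colour (u 1) +_) k*q≡ ⟩
      colour (u 1) + ((k ∸ 1) * q + q) ≡⟨ +-assoc (colour (u 1)) _ q ⟨
      colour (u 1) + (k ∸ 1) * q + q   ≤⟨ +-monoˡ-≤ q (unroll-path k 2≤k ≤-refl) ⟩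
      unroll (u k) + q                 ≤⟨ unroll-closing closing ⟩
      colour (u 1) + p                 ∎))
      where
      open ≤-Reasoning
      open Unrolled (u 1)
      1≤k : 1 ≤ k
      1≤k = ≤-trans (s≤s z≤n) 2≤k
      k*q≡ : k * q ≡ (k ∸ 1) * q + q
      k*q≡ = trans (cong (_* q) (sym (m+[n∸m]≡n 1≤k))) (+-comm q _)
      unroll-path : ∀ i → 2 ≤ i → i ≤ k → colour (u 1) + (i ∸ 1) * q ≤ unroll (u i)
      unroll-path 1 (s≤s ()) _
      unroll-path 2 _ 2≤k =
        subst (λ t → colour (u 1) + t ≤ unroll (u 2)) (sym (+-identityʳ q)) (proj₁ (unroll-fromBase (u 2) (path 1 (s≤s z≤n) 1≤k)))
      unroll-path (suc (suc (suc i))) _ i+3≤k = begin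
        colour (u 1) + (q + suc i * q)   ≡⟨ cong (colour (u 1) +_) (+-comm q _) ⟩
        colour (u 1) + (suc i * q + q)   ≡⟨ +-assoc (colour (u 1)) _ q ⟨
        colour (u 1) + suc i * q + q     ≤⟨ +-monoˡ-≤ q (unroll-path (suc (suc i)) (s≤s (s≤s z≤n)) i+2≤k) ⟩
        unroll (u (suc (suc i))) + q     ≤⟨ unroll-step _ _ (keyOrder⇒cyclicallyOrdered rank (ordered _ _ (s≤s (s≤s z≤n)) ≤-refl i+3≤k))
                                                            (path _ (s≤s z≤n) i+2≤k) ⟩
        unroll (u (suc (suc (suc i))))   ∎
        where
        i+2≤k : suc (suc i) ≤ k
        i+2≤k = ≤-trans (n≤1+n _) i+3≤k
      unroll-closing : ClosesUp (suc k) X u → unroll (u k) + q ≤ colour (u 1) + p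
      unroll-closing (inj₁ returns) = proj₂ (unroll-fromBase (u k)
        (trans (Graph.adj-sym G (u 1) (u k)) (subst (λ v → Edge X (u k) v) returns (path k 1≤k ≤-refl))))
      unroll-closing (inj₂ (_ , last)) = ≤-trans
        (unroll-step (u k) (u (suc k)) (keyOrder⇒cyclicallyOrdered rank (cyclic _ _ _ (cyclic _ _ _ last))) (path k 1≤k ≤-refl))
        (unroll-bounded (u (suc k)))
        where open IsCircularOrdering (COGraph.isCO X)

  admissibleBelow⇒admitsHFree : ∀ k → 2 ≤ k → ∀ {n} (G : Graph n) → AdmissibleBelow k G → AdmitsHFree (suc k) G
  admissibleBelow⇒admitsHFree k 2≤k G (p , q′ , (_ , _ , c , hom) , p<kq) =
    COGraph.cord X , COGraph.isCO X , ¬SP→⇒HFree (suc k) X (noSP 2≤k)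
    where open ColourOrder k G p q′ c hom p<kq

  module Cut {n : ℕ} {C : Fin n → Fin n → Fin n → Bool} (isC : IsCircularOrdering C) (o : Fin n) where

    open IsCircularOrdering isC renaming (trans to cyc-trans)

    private
      true-and-false : ∀ {b} → b ≡ true → b ≡ false → ⊥
      true-and-false refl ()

    cyc-distinct : ∀ {x y z} → C x y z ≡ true → x ≢ y × y ≢ z × x ≢ z
    cyc-distinct {x} {y} {z} h = x≢y , y≢z , x≢z
      where
      x≢y : x ≢ y
      x≢y refl = true-and-false (cyclic x x z h) (asym x x z h)
      y≢z : y ≢ z
      y≢z refl = true-and-false h (asym x y y h)
      x≢z : x ≢ z
      x≢z refl = true-and-false (cyclic x y x h) (asym y x x (cyclic x y x h))

    _≺_ : Fin n → Fin n → Set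
    x ≺ y = (x ≡ o × y ≢ o) ⊎ C o x y ≡ true

    _≺?_ : ∀ x y → Dec (x ≺ y)
    x ≺? y = ((x Finₚ.≟ o) ×-dec ¬? (y Finₚ.≟ o)) ⊎-dec (C o x y Boolₚ.≟ true)

    ≺-irrefl : ∀ {x} → ¬ x ≺ x
    ≺-irrefl (inj₁ (x≡o , x≢o)) = x≢o x≡o
    ≺-irrefl (inj₂ h)           = proj₁ (proj₂ (cyc-distinct h)) refl

    ≺⇒≢ : ∀ {x y} → x ≺ y → x ≢ y
    ≺⇒≢ x≺y refl = ≺-irrefl x≺y

    ≺-trans : ∀ {x y z} → x ≺ y → y ≺ z → x ≺ z
    ≺-trans (inj₁ (_ , y≢o)) (inj₁ (y≡o , _)) = contradiction y≡o y≢o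
    ≺-trans (inj₁ (x≡o , _)) (inj₂ h)         = inj₁ (x≡o , proj₂ (proj₂ (cyc-distinct h)) ∘ sym)
    ≺-trans (inj₂ h)         (inj₁ (y≡o , _)) = contradiction (sym y≡o) (proj₂ (proj₂ (cyc-distinct h)))
    ≺-trans (inj₂ h)         (inj₂ h′)        = inj₂ (cyc-trans o _ _ _ h h′)

    ≺-total : ∀ {x y} → x ≢ y → x ≺ y ⊎ y ≺ x
    ≺-total {x} {y} x≢y with x Finₚ.≟ o | y Finₚ.≟ o
    ... | yes x≡o | yes y≡o = contradiction (trans x≡o (sym y≡o)) x≢y
    ... | yes x≡o | no y≢o  = inj₁ (inj₁ (x≡o , y≢o))
    ... | no x≢o  | yes y≡o = inj₂ (inj₁ (y≡o , x≢o))
    ... | no x≢o  | no y≢o  = Data.Sum.map inj₂ inj₂ (total o x y (x≢o ∘ sym) x≢y (y≢o ∘ sym))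

    ≺-≺⇒cyc : ∀ {x y z} → x ≺ y → y ≺ z → C x y z ≡ true
    ≺-≺⇒cyc (inj₁ (_ , y≢o)) (inj₁ (y≡o , _)) = contradiction y≡o y≢o
    ≺-≺⇒cyc {y = y} {z} (inj₁ (refl , _)) (inj₂ h) = h
    ≺-≺⇒cyc (inj₂ h) (inj₁ (y≡o , _)) = contradiction (sym y≡o) (proj₂ (proj₂ (cyc-distinct h)))
    ≺-≺⇒cyc {x} {y} {z} (inj₂ oxy) (inj₂ oyz) with total x y z x≢y y≢z x≢z
      where
      x≢y = proj₁ (proj₂ (cyc-distinct oxy))
      y≢z = proj₁ (proj₂ (cyc-distinct oyz))
      x≢z : x ≢ z
      x≢z refl = true-and-false oxy (asym o y x oyz)
    ... | inj₁ xyz = xyz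
    ... | inj₂ xzy = ⊥-elim (true-and-false (cyclic x o y (cyclic y x o yxo)) (asym o x y oxy))
      where
      yxo : C y x o ≡ true
      yxo = cyc-trans y x z o (cyclic z y x (cyclic x z y xzy)) (cyclic o y z oyz)

    ≺-chain : (s : ℕ → Fin n) (L : ℕ) → (∀ i → i < L → s i ≺ s (suc i)) →
              ∀ {a b} → a < b → b ≤ L → s a ≺ s b
    ≺-chain s L steps {a} {suc b} a<1+b 1+b≤L with m≤n⇒m<n∨m≡n (s≤s⁻¹ a<1+b)
    ... | inj₁ a<b  = ≺-trans (≺-chain s L steps a<b (≤-trans (n≤1+n b) 1+b≤L)) (steps b 1+b≤L)
    ... | inj₂ refl = steps a 1+b≤L

    ≼-chain : (s : ℕ → Fin n) (L : ℕ) → (∀ i → i < L → s i ≺ s (suc i)) →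
              ∀ {a b} → a ≤ b → b ≤ L → s a ≡ s b ⊎ s a ≺ s b
    ≼-chain s L steps a≤b b≤L with m≤n⇒m<n∨m≡n a≤b
    ... | inj₁ a<b  = inj₂ (≺-chain s L steps a<b b≤L)
    ... | inj₂ refl = inj₁ refl

  module Ranking {n : ℕ} {R : Fin n → Fin n → Set} (R? : ∀ u v → Dec (R u v)) where

    Walk : ℕ → Fin n → Set
    Walk t v = Σ (ℕ → Fin n) λ w → w 0 ≡ v × (∀ i → i < t → R (w i) (w (suc i)))

    walk-∷ : ∀ {t u v} → R u v → Walk t v → Walk (suc t) u
    walk-∷ {t} {u} uv (w , w0≡v , steps) = w′ , refl , steps′
      where
      w′ : ℕ → Fin n
      w′ zero    = u
      w′ (suc i) = w i
      steps′ : ∀ i → i < suc t → R (w′ i) (w′ (suc i))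
      steps′ zero    _         = subst (R u) (sym w0≡v) uv
      steps′ (suc i) (s≤s i<t) = steps i i<t

    walk-uncons : ∀ {t v} → Walk (suc t) v → ∃ λ u → R v u × Walk t u
    walk-uncons (w , w0≡v , steps) =
      w 1 , subst (λ x → R x (w 1)) w0≡v (steps 0 (s≤s z≤n)) , w ∘ suc , refl , λ i i<t → steps (suc i) (s≤s i<t)

    walk? : ∀ t v → Dec (Walk t v)
    walk? zero    v = yes ((λ _ → v) , refl , λ _ ())
    walk? (suc t) v = map′ (λ (u , vu , walk) → walk-∷ vu walk) walk-uncons
                           (Finₚ.any? λ u → R? v u ×-dec walk? t u)

    longestWalk : ℕ → Fin n → ℕ
    longestWalk zero    v = 0
    longestWalk (suc t) v with walk? (suc t) v
    ... | yes _ = suc t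
    ... | no  _ = longestWalk t v

    longestWalk-walk : ∀ t v → Walk (longestWalk t v) v
    longestWalk-walk zero    v = (λ _ → v) , refl , λ _ ()
    longestWalk-walk (suc t) v with walk? (suc t) v
    ... | yes w = w
    ... | no  _ = longestWalk-walk t v

    longestWalk-≤ : ∀ t v → longestWalk t v ≤ t
    longestWalk-≤ zero    v = z≤n
    longestWalk-≤ (suc t) v with walk? (suc t) v
    ... | yes _ = ≤-refl
    ... | no  _ = m≤n⇒m≤1+n (longestWalk-≤ t v)

    longestWalk-maximal : ∀ t v {s} → s ≤ t → Walk s v → s ≤ longestWalk t v
    longestWalk-maximal zero    v z≤n _ = z≤n
    longestWalk-maximal (suc t) v s≤t w with walk? (suc t) v
    ... | yes _ = s≤t
    ... | no ¬w with m≤n⇒m<n∨m≡n s≤t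
    ...   | inj₁ s<1+t = longestWalk-maximal t v (s≤s⁻¹ s<1+t) w
    ...   | inj₂ refl  = contradiction w ¬w

    ranking : ∀ B → (∀ v → ¬ Walk (suc B) v) →
              Σ (Fin n → ℕ) λ g → (∀ {u v} → R u v → g u < g v) × (∀ v → g v ≤ B)
    ranking B noLongWalk = (λ v → B ∸ longestWalk B v) , increasing , (λ v → m∸n≤m B (longestWalk B v))
      where
      increasing : ∀ {u v} → R u v → B ∸ longestWalk B u < B ∸ longestWalk B v
      increasing {u} {v} uv = ∸-monoʳ-< (longestWalk-maximal B u longer≤B longer) (longestWalk-≤ B u)
        where
        longer : Walk (suc (longestWalk B v)) u
        longer = walk-∷ uv (longestWalk-walk B v)
        longer≤B : suc (longestWalk B v) ≤ B
        longer≤B with m≤n⇒m<n∨m≡n (longestWalk-≤ B v)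
        ... | inj₁ hv<B = hv<B
        ... | inj₂ hv≡B = contradiction (subst (λ t → Walk (suc t) u) hv≡B longer) (noLongWalk u)

  -- The colour a·N + g of a vertex at level a with potential g ≤ B, where N = B + 2.  Consecutive
  -- levels are separated by the potential, and the extreme levels 0 and top by its reverse.
  levels-farApart : ∀ a e r ga gb B {top} → a + suc e + r ≡ top → ga ≤ B → gb ≤ B →
                    (e ≡ 0 → ga < gb) → (a ≡ 0 → r ≡ 0 → gb < ga) →
                    FarApart (suc B + top * suc (suc B)) (suc (suc B)) (a * suc (suc B) + ga) ((a + suc e) * suc (suc B) + gb)
  levels-farApart a e r ga gb B {top} levels ga≤B gb≤B consecutive extreme = farApart-intro lower upper
    where
    N : ℕ
    N = suc (suc B)
    open ≤-Reasoning
    ga≤eN+gb : ∀ e → (e ≡ 0 → ga < gb) → ga ≤ e * N + gb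
    ga≤eN+gb zero    cons = <⇒≤ (cons refl)
    ga≤eN+gb (suc e) _    = ≤-trans (≤-trans ga≤B (≤-trans (n≤1+n B) (n≤1+n (suc B))))
                                    (≤-trans (m≤m+n N (e * N)) (m≤m+n (suc e * N) gb))
    lower : N + (a * N + ga) ≤ (a + suc e) * N + gb
    lower = begin
      N + (a * N + ga)           ≡⟨ lemma a N ga ⟩
      (a * N + N) + ga           ≤⟨ +-monoʳ-≤ (a * N + N) (ga≤eN+gb e consecutive) ⟩
      (a * N + N) + (e * N + gb) ≡⟨ lemma′ a e N gb ⟨
      (a + suc e) * N + gb       ∎
      where
      lemma : ∀ a N ga → N + (a * N + ga) ≡ (a * N + N) + ga
      lemma = solve-∀
      lemma′ : ∀ a e N gb → (a + suc e) * N + gb ≡ (a * N + N) + (e * N + gb)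
      lemma′ = solve-∀
    gb<ga+aN+rN : ∀ a r → (a ≡ 0 → r ≡ 0 → gb < ga) → suc gb ≤ ga + a * N + r * N
    gb<ga+aN+rN zero zero ext = ≤-trans (ext refl refl) (≤-reflexive (sym (trans (+-identityʳ (ga + 0)) (+-identityʳ ga))))
    gb<ga+aN+rN (suc a) r _ = ≤-trans (≤-trans (s≤s gb≤B) (n≤1+n (suc B)))
      (≤-trans (≤-trans (m≤m+n N (a * N)) (m≤n+m (suc a * N) ga)) (m≤m+n (ga + suc a * N) (r * N)))
    gb<ga+aN+rN zero (suc r) _ = ≤-trans (≤-trans (s≤s gb≤B) (n≤1+n (suc B)))
      (≤-trans (m≤m+n N (r * N)) (m≤n+m (suc r * N) (ga + 0 * N)))
    upper : (a + suc e) * N + gb + N ≤ (a * N + ga) + (suc B + top * N)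
    upper = begin
      (a + suc e) * N + gb + N                           ≡⟨ +-assoc ((a + suc e) * N) gb N ⟩
      (a + suc e) * N + (gb + N)                         ≡⟨ cong ((a + suc e) * N +_) (+-suc gb (suc B)) ⟩
      (a + suc e) * N + (suc gb + suc B)                 ≤⟨ +-monoʳ-≤ ((a + suc e) * N) (+-monoˡ-≤ (suc B) (gb<ga+aN+rN a r extreme)) ⟩
      (a + suc e) * N + ((ga + a * N + r * N) + suc B)   ≡⟨ lemma a e r ga B N ⟨
      a * N + ga + (suc B + (a + suc e + r) * N)         ≡⟨ cong (λ t → a * N + ga + (suc B + t * N)) levels ⟩
      (a * N + ga) + (suc B + top * N)                   ∎
      where
      lemma : ∀ a e r ga B N → a * N + ga + (suc B + (a + suc e + r) * N) ≡ (a + suc e) * N + ((ga + a * N + r * N) + suc B)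
      lemma = solve-∀

  -- An ℋ_{k+1}-free circular ordering gives a colouring into K_{P/N} with P < kN

  module OrderColouring (ℓ : ℕ) {n′ : ℕ} (G : Graph (suc n′)) {C : Fin (suc n′) → Fin (suc n′) → Fin (suc n′) → Bool}
                        (isC : IsCircularOrdering C) where

    top k n : ℕ
    top = suc ℓ
    k = suc top
    n = suc n′

    X : COGraph n
    X = record { graph = G ; cord = C ; isCO = isC }

    open Cut isC F.zero
    open IsCircularOrdering isC using (cyclic)

    adj : Fin n → Fin n → Bool
    adj = Graph.adj G

    edge-sym : ∀ {u v} → adj u v ≡ true → adj v u ≡ true
    edge-sym {u} {v} = trans (Graph.adj-sym G v u)

    edge⇒≢ : ∀ {u v} → adj u v ≡ true → u ≢ v
    edge⇒≢ {u} uv refl with trans (sym uv) (Graph.adj-irrefl G u)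
    ... | ()

    -- the last edge lands on s₀ or outside the arc from s₀ to s_top
    increasingWalk⇒SP→ : (s : ℕ → Fin n) → (∀ i → i < k → adj (s i) (s (suc i)) ≡ true) →
                          (∀ i → i < top → s i ≺ s (suc i)) →
                          s k ≡ s 0 ⊎ s k ≺ s 0 ⊎ s top ≺ s k → SP→ (suc k) X
    increasingWalk⇒SP→ s edges steps closing = s ∘ (_∸ 1) , path , distinct , ordered , closes closing
      where
      chain : ∀ {a b} → a < b → b ≤ top → s a ≺ s b
      chain = ≺-chain s top steps
      path : ∀ i → 1 ≤ i → i ≤ k → adj (s (i ∸ 1)) (s i) ≡ true
      path (suc i) _ i<k = edges i i<k
      distinct : ∀ i j → 1 ≤ i → i < j → j ≤ k → s (i ∸ 1) ≢ s (j ∸ 1)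
      distinct (suc i) (suc j) _ (s≤s i<j) (s≤s j≤top) = ≺⇒≢ (chain i<j j≤top)
      ordered : ∀ i j → 1 < i → i < j → j ≤ k → C (s 0) (s (i ∸ 1)) (s (j ∸ 1)) ≡ true
      ordered (suc i) (suc j) (s≤s 0<i) (s≤s i<j) (s≤s j≤top) =
        ≺-≺⇒cyc (chain 0<i (≤-trans (<⇒≤ i<j) j≤top)) (chain i<j j≤top)
      s0≼ : ∀ {i} → i ≤ top → s 0 ≡ s i ⊎ s 0 ≺ s i
      s0≼ = ≼-chain s top steps z≤n
      closes : s k ≡ s 0 ⊎ s k ≺ s 0 ⊎ s top ≺ s k → ClosesUp (suc k) X (s ∘ (_∸ 1))
      closes (inj₁ returns) = inj₁ returns
      closes (inj₂ (inj₁ sk≺s0)) = inj₂ (fresh , last)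
        where
        fresh : ∀ i → 1 ≤ i → i ≤ k → s k ≢ s (i ∸ 1)
        fresh (suc i) _ (s≤s i≤top) with s0≼ i≤top
        ... | inj₁ s0≡si = ≺⇒≢ (subst (s k ≺_) s0≡si sk≺s0)
        ... | inj₂ s0≺si = ≺⇒≢ (≺-trans sk≺s0 s0≺si)
        last : C (s top) (s k) (s 0) ≡ true
        last = cyclic _ _ _ (cyclic _ _ _ (≺-≺⇒cyc sk≺s0 (chain (s≤s z≤n) ≤-refl)))
      closes (inj₂ (inj₂ stop≺sk)) = inj₂ (fresh , last)
        where
        fresh : ∀ i → 1 ≤ i → i ≤ k → s k ≢ s (i ∸ 1)
        fresh (suc i) _ (s≤s i≤top) with ≼-chain s top steps i≤top ≤-refl
        ... | inj₁ si≡stop = ≺⇒≢ (subst (_≺ s k) (sym si≡stop) stop≺sk) ∘ sym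
        ... | inj₂ si≺stop = ≺⇒≢ (≺-trans si≺stop stop≺sk) ∘ sym
        last : C (s top) (s k) (s 0) ≡ true
        last = cyclic _ _ _ (≺-≺⇒cyc (chain (s≤s z≤n) ≤-refl) stop≺sk)

    module WithoutSP (¬sp : ¬ SP→ (suc k) X) where

      module ForwardWalks = Ranking (λ u v → (adj u v Boolₚ.≟ true) ×-dec (u ≺? v))

      noLongForwardWalk : ∀ v → ¬ ForwardWalks.Walk k v
      noLongForwardWalk v (w , _ , steps) =
        ¬sp (increasingWalk⇒SP→ w (proj₁ ∘₂ steps) (λ i i<top → proj₂ (steps i (m≤n⇒m≤1+n i<top)))
                                 (inj₂ (inj₂ (proj₂ (steps top ≤-refl)))))

      private
        levels : Σ (Fin n → ℕ) λ g → (∀ {u v} → adj u v ≡ true × u ≺ v → g u < g v) × (∀ v → g v ≤ top)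
        levels = ForwardWalks.ranking top noLongForwardWalk

      level : Fin n → ℕ
      level = proj₁ levels

      level-≤ : ∀ v → level v ≤ top
      level-≤ = proj₂ (proj₂ levels)

      level-increasing : ∀ {u v} → adj u v ≡ true → u ≺ v → level u < level v
      level-increasing uv u≺v = proj₁ (proj₂ levels) (uv , u≺v)

      level-edge : ∀ {u v} → adj u v ≡ true → (u ≺ v × level u < level v) ⊎ (v ≺ u × level v < level u)
      level-edge uv with ≺-total (edge⇒≢ uv)
      ... | inj₁ u≺v = inj₁ (u≺v , level-increasing uv u≺v)
      ... | inj₂ v≺u = inj₂ (v≺u , level-increasing (edge-sym uv) v≺u)

      Tight : ℕ → ℕ → Set
      Tight a b = b ≡ suc a ⊎ (a ≡ top × b ≡ 0)

      tight? : ∀ a b → Dec (Tight a b)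
      tight? a b = (b ≟ suc a) ⊎-dec ((a ≟ top) ×-dec (b ≟ 0))

      module TightWalks = Ranking (λ u v → (adj u v Boolₚ.≟ true) ×-dec tight? (level u) (level v))

      tight-step : ∀ {u v} → adj u v ≡ true → Tight (level u) (level v) →
                   (level u < top × level v ≡ suc (level u) × u ≺ v) ⊎ (level u ≡ top × level v ≡ 0)
      tight-step uv (inj₂ wraps) = inj₂ wraps
      tight-step {u} {v} uv (inj₁ climbs) = inj₁ (subst (_≤ top) climbs (level-≤ v) , climbs , u≺v)
        where
        u≺v : u ≺ v
        u≺v with level-edge uv
        ... | inj₁ (u≺v , _)  = u≺v
        ... | inj₂ (_ , lv<lu) = contradiction (subst (level u <_) (sym climbs) ≤-refl) (<-asym lv<lu)

      long : ℕ
      long = suc (top + n * k)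

      -- Every k consecutive tight edges from level 0 wind once around the circle, so a long tight
      -- walk visits n + 1 ≺-increasing vertices.
      module TightWalk (w : ℕ → Fin n)
                       (tight : ∀ i → i < long → adj (w i) (w (suc i)) ≡ true × Tight (level (w i)) (level (w (suc i)))) where

        lv : ℕ → ℕ
        lv i = level (w i)

        step : ∀ i → i < long → (lv i < top × lv (suc i) ≡ suc (lv i) × w i ≺ w (suc i)) ⊎ (lv i ≡ top × lv (suc i) ≡ 0)
        step i i<long = tight-step (proj₁ (tight i i<long)) (proj₂ (tight i i<long))

        wraps : ∀ i → lv i ≡ top → i < long → lv (suc i) ≡ 0
        wraps i lvi≡top i<long with step i i<long
        ... | inj₁ (lvi<top , _) = contradiction lvi≡top (<⇒≢ lvi<top)
        ... | inj₂ (_ , wrapped) = wrapped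

        reaches0 : ∀ d i → d + lv i ≡ top → d + i < long → lv (suc (d + i)) ≡ 0
        reaches0 zero    i = wraps i
        reaches0 (suc d) i d+lvi≡top d+i<long with step i (≤-<-trans (m≤n+m i (suc d)) d+i<long)
        ... | inj₂ (lvi≡top , _) =
          contradiction (trans (sym d+lvi≡top) (cong (suc d +_) lvi≡top)) (<⇒≢ (m<n+m top (s≤s z≤n)))
        ... | inj₁ (_ , climbs , _) = subst (λ t → lv (suc t) ≡ 0) (+-suc d i)
          (reaches0 d (suc i) (trans (cong (d +_) climbs) (trans (+-suc d (lv i)) d+lvi≡top))
                    (subst (_< long) (sym (+-suc d i)) d+i<long))

        lap : ∀ j → lv j ≡ 0 → j + k ≤ long → lv (j + k) ≡ 0 × w j ≺ w (j + k)
        lap j lvj≡0 j+k≤long = trans (cong lv (+-suc j top)) wrapped , subst (_≺ s k) (cong w (+-identityʳ j)) s0≺sk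
          where
          s : ℕ → Fin n
          s t = w (j + t)
          inRange : ∀ {t} → t < k → j + t < long
          inRange t<k = <-≤-trans (+-monoʳ-< j t<k) j+k≤long
          shift : ∀ t → w (suc (j + t)) ≡ s (suc t)
          shift t = cong w (sym (+-suc j t))
          climbing : ∀ t → t ≤ top → lv (j + t) ≡ t
          climbing zero    _     = trans (cong lv (+-identityʳ j)) lvj≡0
          climbing (suc t) t<top with step (j + t) (inRange (m≤n⇒m≤1+n t<top))
          ... | inj₁ (_ , climbs , _) = trans (cong level (sym (shift t))) (trans climbs (cong suc (climbing t (<⇒≤ t<top))))
          ... | inj₂ (lv≡top , _)     = contradiction (trans (sym (climbing t (<⇒≤ t<top))) lv≡top) (<⇒≢ t<top)
          edges : ∀ t → t < k → adj (s t) (s (suc t)) ≡ true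
          edges t t<k = subst (λ x → adj (s t) x ≡ true) (shift t) (proj₁ (tight (j + t) (inRange t<k)))
          increasing : ∀ t → t < top → s t ≺ s (suc t)
          increasing t t<top with step (j + t) (inRange (m≤n⇒m≤1+n t<top))
          ... | inj₁ (_ , _ , s≺) = subst (s t ≺_) (shift t) s≺
          ... | inj₂ (lv≡top , _) = contradiction (trans (sym (climbing t (<⇒≤ t<top))) lv≡top) (<⇒≢ t<top)
          wrapped : lv (suc (j + top)) ≡ 0
          wrapped = wraps (j + top) (climbing top ≤-refl) (inRange ≤-refl)
          s0≺sk : s 0 ≺ s k
          s0≺sk with s k Finₚ.≟ s 0
          ... | yes returns = contradiction (increasingWalk⇒SP→ s edges increasing (inj₁ returns)) ¬sp
          ... | no ¬returns with ≺-total ¬returns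
          ...   | inj₁ sk≺s0 = contradiction (increasingWalk⇒SP→ s edges increasing (inj₂ (inj₁ sk≺s0))) ¬sp
          ...   | inj₂ s0≺sk = s0≺sk

        first0 : ℕ
        first0 = suc (top ∸ lv 0)

        lv-first0 : lv first0 ≡ 0
        lv-first0 = subst (λ t → lv (suc t) ≡ 0) (+-identityʳ _)
          (reaches0 (top ∸ lv 0) 0 (m∸n+n≡m (level-≤ (w 0)))
                    (s≤s (≤-trans (≤-reflexive (+-identityʳ _)) (≤-trans (m∸n≤m top (lv 0)) (m≤m+n top (n * k))))))

        lapStart : ℕ → ℕ
        lapStart m = first0 + m * k

        lapStart-suc : ∀ m → lapStart m + k ≡ lapStart (suc m)
        lapStart-suc m = trans (+-assoc first0 (m * k) k) (cong (first0 +_) (+-comm (m * k) k))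

        lap-fits : ∀ {m} → m < n → lapStart m + k ≤ long
        lap-fits {m} m<n = begin
          first0 + m * k + k ≤⟨ +-monoˡ-≤ k (+-monoˡ-≤ (m * k) (s≤s (m∸n≤m top (lv 0)))) ⟩
          k + m * k + k     ≡⟨ +-comm (k + m * k) k ⟩
          k + (k + m * k)   ≤⟨ +-monoʳ-≤ k (*-monoˡ-≤ k m<n) ⟩
          k + n * k         ∎
          where open ≤-Reasoning

        lapStart-level : ∀ m → m ≤ n → lv (lapStart m) ≡ 0
        lapStart-level zero    _      = trans (cong lv (+-identityʳ first0)) lv-first0
        lapStart-level (suc m) 1+m≤n  = subst (λ t → lv t ≡ 0) (lapStart-suc m)
          (proj₁ (lap (lapStart m) (lapStart-level m (<⇒≤ 1+m≤n)) (lap-fits 1+m≤n)))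

        lapStart-≺ : ∀ m → m < n → w (lapStart m) ≺ w (lapStart (suc m))
        lapStart-≺ m m<n = subst (λ t → w (lapStart m) ≺ w t) (lapStart-suc m)
          (proj₂ (lap (lapStart m) (lapStart-level m (<⇒≤ m<n)) (lap-fits m<n)))

        impossible : ⊥
        impossible with Finₚ.pigeonhole (n<1+n n) (λ (i : Fin (suc n)) → w (lapStart (toℕ i)))
        ... | i , j , i<j , same = ≺⇒≢ (≺-chain (w ∘ lapStart) n lapStart-≺ i<j (s≤s⁻¹ (Finₚ.toℕ<n j))) same

      noLongTightWalk : ∀ v → ¬ TightWalks.Walk long v
      noLongTightWalk v (w , _ , tight) = TightWalk.impossible w tight

      private
        potentials : Σ (Fin n → ℕ) λ g → (∀ {u v} → adj u v ≡ true × Tight (level u) (level v) → g u < g v) ×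
                                         (∀ v → g v ≤ top + n * k)
        potentials = TightWalks.ranking (top + n * k) noLongTightWalk

      potential : Fin n → ℕ
      potential = proj₁ potentials

      potential-≤ : ∀ v → potential v ≤ top + n * k
      potential-≤ = proj₂ (proj₂ potentials)

      potential-increasing : ∀ {u v} → adj u v ≡ true → Tight (level u) (level v) → potential u < potential v
      potential-increasing uv tight = proj₁ (proj₂ potentials) (uv , tight)

      -- P = kN − 1
      N P : ℕ
      N = suc (suc (top + n * k))
      P = suc (top + n * k) + top * N

      colourℕ : Fin n → ℕ
      colourℕ v = level v * N + potential v

      colourℕ<P : ∀ v → colourℕ v < P
      colourℕ<P v = begin-strict
        level v * N + potential v          <⟨ +-monoʳ-< (level v * N) (s≤s (potential-≤ v)) ⟩
        level v * N + suc (top + n * k)    ≤⟨ +-monoˡ-≤ _ (*-monoˡ-≤ N (level-≤ v)) ⟩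
        top * N + suc (top + n * k)        ≡⟨ +-comm (top * N) _ ⟩
        P                                  ∎
        where open ≤-Reasoning

      colourℕ-farApart : ∀ {u v} → adj u v ≡ true → level u < level v → FarApart P N (colourℕ u) (colourℕ v)
      colourℕ-farApart {u} {v} uv lu<lv =
        subst (λ t → FarApart P N (colourℕ u) (t * N + potential v)) (sym lv≡)
          (levels-farApart (level u) e r (potential u) (potential v) (top + n * k) (sym top≡)
                           (potential-≤ u) (potential-≤ v) consecutive extreme)
        where
        e r : ℕ
        e = level v ∸ suc (level u)
        r = top ∸ level v
        lv≡ : level v ≡ level u + suc e
        lv≡ = trans (sym (m+[n∸m]≡n lu<lv)) (sym (+-suc (level u) e))
        top≡ : top ≡ level u + suc e + r
        top≡ = trans (sym (m+[n∸m]≡n (level-≤ v))) (cong (_+ r) lv≡)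
        consecutive : e ≡ 0 → potential u < potential v
        consecutive e≡0 = potential-increasing uv (inj₁ (trans lv≡ (trans (cong (λ d → level u + suc d) e≡0) (+-comm (level u) 1))))
        extreme : level u ≡ 0 → r ≡ 0 → potential v < potential u
        extreme lu≡0 r≡0 = potential-increasing (edge-sym uv) (inj₂ (lv≡top , lu≡0))
          where
          lv≡top : level v ≡ top
          lv≡top = trans (sym (+-identityʳ (level v))) (trans (cong (level v +_) (sym r≡0)) (m+[n∸m]≡n (level-≤ v)))

      colouring : Hom→K G P N
      colouring = hom→K-fromℕ G colourℕ colourℕ<P λ u v uv →
        Data.Sum.[ (λ (_ , lu<lv) → colourℕ-farApart uv lu<lv)
                 , (λ (_ , lv<lu) → farApart-sym {P} {N} {colourℕ v} (colourℕ-farApart (edge-sym uv) lv<lu)) ]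
                 (level-edge uv)

      N≤P : N ≤ P
      N≤P = s≤s (m<m+n _ (s≤s z≤n))

      P<kN : P < k * N
      P<kN = n<1+n P

  -- Reducing the numerator of a circular colouring to at most |V(G)|

  module Rotation (P s : ℕ) (s<P : s < P) where

    rotate : ℕ → ℕ
    rotate a with a + s <? P
    ... | yes _ = a + s
    ... | no  _ = a + s ∸ P

    rotate-cases : ∀ a → (rotate a ≡ a + s × a + s < P) ⊎ (rotate a + P ≡ a + s × P ≤ a + s)
    rotate-cases a with a + s <? P
    ... | yes a+s<P = inj₁ (refl , a+s<P)
    ... | no  a+s≮P = inj₂ (m∸n+n≡m (≮⇒≥ a+s≮P) , ≮⇒≥ a+s≮P)

    rotate-< : ∀ {a} → a < P → rotate a < P
    rotate-< {a} a<P with rotate-cases a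
    ... | inj₁ (ra≡ , a+s<P) = subst (_< P) (sym ra≡) a+s<P
    ... | inj₂ (ra+P≡ , _)   = +-cancelʳ-< P (rotate a) P (subst (_< P + P) (sym ra+P≡) (+-mono-< a<P s<P))

    private
      +s : ∀ {x y} → x ≤ y → x + s ≤ y + s
      +s = +-monoˡ-≤ s

    rotate-farApart≤ : ∀ {Q a b} → 1 ≤ Q → a ≤ b → FarApart P Q a b → FarApart P Q (rotate a) (rotate b)
    rotate-farApart≤ {Q} {a} {b} 1≤Q a≤b far with farApart-elim 1≤Q far a≤b | rotate-cases a | rotate-cases b
    ... | lower , upper | inj₁ (ra≡ , _) | inj₁ (rb≡ , _) rewrite ra≡ | rb≡ = farApart-intro
      (subst (_≤ b + s) (+-assoc Q a s) (+s lower))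
      (subst₂ _≤_ (m+n+o≡m+o+n b Q s) (m+n+o≡m+o+n a P s) (+s upper))
    ... | _ | inj₂ (_ , P≤a+s) | inj₁ (_ , b+s<P) = contradiction (≤-trans P≤a+s (+s a≤b)) (<⇒≱ b+s<P)
    ... | lower , upper | inj₂ (ra+P≡ , _) | inj₂ (rb+P≡ , _) = farApart-intro
      (+-cancelʳ-≤ P _ _ (begin
        Q + rotate a + P   ≡⟨ trans (+-assoc Q _ P) (cong (Q +_) ra+P≡) ⟩
        Q + (a + s)        ≡⟨ +-assoc Q a s ⟨
        Q + a + s          ≤⟨ +s lower ⟩
        b + s              ≡⟨ rb+P≡ ⟨
        rotate b + P       ∎))
      (+-cancelʳ-≤ P _ _ (begin
        rotate b + Q + P   ≡⟨ trans (m+n+o≡m+o+n (rotate b) Q P) (cong (_+ Q) rb+P≡) ⟩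
        b + s + Q          ≡⟨ m+n+o≡m+o+n b s Q ⟩
        b + Q + s          ≤⟨ +s upper ⟩
        a + P + s          ≡⟨ trans (m+n+o≡m+o+n a P s) (cong (_+ P) (sym ra+P≡)) ⟩
        rotate a + P + P   ∎))
      where open ≤-Reasoning
    ... | lower , upper | inj₁ (ra≡ , _) | inj₂ (rb+P≡ , _) = farApart-sym {P} {Q} {rotate b} (farApart-intro
      (+-cancelʳ-≤ P _ _ (begin
        Q + rotate b + P   ≡⟨ trans (+-assoc Q _ P) (cong (Q +_) rb+P≡) ⟩
        Q + (b + s)        ≡⟨ trans (sym (+-assoc Q b s)) (cong (_+ s) (+-comm Q b)) ⟩
        b + Q + s          ≤⟨ +s upper ⟩
        a + P + s          ≡⟨ trans (m+n+o≡m+o+n a P s) (cong (_+ P) (sym ra≡)) ⟩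
        rotate a + P       ∎))
      (begin
        rotate a + Q       ≡⟨ trans (cong (_+ Q) ra≡) (trans (m+n+o≡m+o+n a s Q) (cong (_+ s) (+-comm a Q))) ⟩
        Q + a + s          ≤⟨ +s lower ⟩
        b + s              ≡⟨ rb+P≡ ⟨
        rotate b + P       ∎))
      where open ≤-Reasoning

    rotate-farApart : ∀ {Q a b} → 1 ≤ Q → FarApart P Q a b → FarApart P Q (rotate a) (rotate b)
    rotate-farApart 1≤Q = farApart-wlog rotate (rotate-farApart≤ 1≤Q)

    rotate-onto-last : ∀ {m a} → s + suc m ≡ P → a < P → suc (rotate a) ≡ P → a ≡ m
    rotate-onto-last {m} {a} s+1+m≡P a<P 1+ra≡P with rotate-cases a
    ... | inj₁ (ra≡ , _) = +-cancelʳ-≡ s a m (suc-injective (begin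
        suc (a + s)   ≡⟨ cong suc ra≡ ⟨
        suc (rotate a) ≡⟨ 1+ra≡P ⟩
        P             ≡⟨ s+1+m≡P ⟨
        s + suc m     ≡⟨ trans (+-suc s m) (cong suc (+-comm s m)) ⟩
        suc (m + s)   ∎))
      where open ≡-Reasoning
    ... | inj₂ (ra+P≡ , _) = contradiction (trans (cong suc (sym ra+P≡)) (cong (_+ P) 1+ra≡P))
                                           (<⇒≢ (subst (_≤ P + P) (cong suc (+-suc a s)) (+-mono-≤ a<P s<P)))

  *≤⇒≤/ : ∀ {a y} P .{{_ : NonZero P}} → a * P ≤ y → a ≤ y / P
  *≤⇒≤/ {a} P h = subst (_≤ _ / P) (m*n/n≡m a P) (/-monoˡ-≤ P h)

  -- Pq − pQ = 1: the map a ↦ ⌊(a + 1)p / P⌋ sends K_{P/Q} without its last vertex into K_{p/q}.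
  module Farey {P p Q q : ℕ} .{{_ : NonZero P}} .{{_ : NonZero p}} (neighbours : P * q ≡ p * Q + 1) where

    P∤tp : ∀ {t} m → 1 ≤ t → t < P → t * p ≢ m * P
    P∤tp {t} m 1≤t t<P tp≡mP = <⇒≱ t<P (∣⇒≤ {{>-nonZero 1≤t}} P∣t)
      where
      P∣t : P ∣ t
      P∣t = ∣m+n∣m⇒∣n (divides (t * q) (begin
        m * Q * P + t     ≡⟨ cong (_+ t) (lemma m Q P) ⟩
        m * P * Q + t     ≡⟨ cong (λ z → z * Q + t) tp≡mP ⟨
        t * p * Q + t     ≡⟨ lemma′ t p Q ⟩
        t * (p * Q + 1)   ≡⟨ cong (t *_) neighbours ⟨
        t * (P * q)       ≡⟨ lemma″ t P q ⟩
        t * q * P         ∎)) (n∣m*n (m * Q))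
        where
        open ≡-Reasoning
        lemma : ∀ m Q P → m * Q * P ≡ m * P * Q
        lemma = solve-∀
        lemma′ : ∀ t p Q → t * p * Q + t ≡ t * (p * Q + 1)
        lemma′ = solve-∀
        lemma″ : ∀ t P q → t * (P * q) ≡ t * q * P
        lemma″ = solve-∀

    φ : ℕ → ℕ
    φ a = suc a * p / P

    φ-< : ∀ {a} → suc a < P → φ a < p
    φ-< {a} 1+a<P = m<n*o⇒m/o<n (subst (suc a * p <_) (*-comm P p) (*-monoˡ-< p 1+a<P))

    φ-lower : ∀ {a b} → suc a < P → Q + a ≤ b → q + φ a ≤ φ b
    φ-lower {a} {b} 1+a<P Q+a≤b = *≤⇒≤/ P (+-cancelʳ-≤ 1 _ _ (begin
      (q + A) * P + 1             ≡⟨ lemma q A P ⟩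
      A * P + P * q + 1           ≡⟨ cong (λ z → A * P + z + 1) neighbours ⟩
      A * P + (p * Q + 1) + 1     ≤⟨ +-monoʳ-≤ (A * P + (p * Q + 1)) 1≤r ⟩
      A * P + (p * Q + 1) + r     ≡⟨ lemma′ A P p Q r ⟩
      r + A * P + Q * p + 1       ≡⟨ cong (λ z → z + Q * p + 1) (m≡m%n+[m/n]*n x P) ⟨
      x + Q * p + 1               ≡⟨ cong (_+ 1) (*-distribʳ-+ p (suc a) Q) ⟨
      (suc a + Q) * p + 1         ≤⟨ +-monoˡ-≤ 1 (*-monoˡ-≤ p (subst (λ z → suc z ≤ suc b) (+-comm Q a) (s≤s Q+a≤b))) ⟩
      suc b * p + 1               ∎))
      where
      open ≤-Reasoning
      x A r : ℕ
      x = suc a * p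
      A = x / P
      r = x % P
      1≤r : 1 ≤ r
      1≤r with r in r≡
      ... | suc _ = s≤s z≤n
      ... | zero  = contradiction (trans (m≡m%n+[m/n]*n x P) (cong (_+ A * P) r≡)) (P∤tp A (s≤s z≤n) 1+a<P)
      lemma : ∀ q A P → (q + A) * P + 1 ≡ A * P + P * q + 1
      lemma = solve-∀
      lemma′ : ∀ A P p Q r → A * P + (p * Q + 1) + r ≡ r + A * P + Q * p + 1
      lemma′ = solve-∀

    φ-upper : ∀ {a b} → suc b < P → b + Q ≤ a + P → φ b + q ≤ φ a + p
    φ-upper {a} {b} 1+b<P b+Q≤a+P = s≤s⁻¹ (*-cancelʳ-< P _ _ (begin-strict
      (y / P + q) * P     ≡⟨ *-distribʳ-+ P (y / P) q ⟩
      y / P * P + q * P   ≤⟨ +-monoˡ-≤ (q * P) (m/n*n≤m y P) ⟩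
      y + q * P           ≡⟨ cong (y +_) (*-comm q P) ⟩
      y + P * q           <⟨ y+Pq<cP ⟩
      c * P               ≡⟨ cong (_* P) (+-comm (A + p) 1) ⟩
      suc (A + p) * P     ∎))
      where
      open ≤-Reasoning
      x y A r c : ℕ
      x = suc a * p
      y = suc b * p
      A = x / P
      r = x % P
      c = A + p + 1
      y+Pq≤cP : y + P * q ≤ c * P
      y+Pq≤cP = begin
        y + P * q                  ≡⟨ cong (y +_) neighbours ⟩
        y + (p * Q + 1)            ≡⟨ lemma y p Q ⟩
        y + Q * p + 1              ≡⟨ cong (_+ 1) (*-distribʳ-+ p (suc b) Q) ⟨
        (suc b + Q) * p + 1        ≤⟨ +-monoˡ-≤ 1 (*-monoˡ-≤ p (s≤s b+Q≤a+P)) ⟩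
        (suc a + P) * p + 1        ≡⟨ cong (_+ 1) (*-distribʳ-+ p (suc a) P) ⟩
        x + P * p + 1              ≡⟨ cong (λ z → z + P * p + 1) (m≡m%n+[m/n]*n x P) ⟩
        r + A * P + P * p + 1      ≡⟨ lemma′ r A P p ⟩
        (r + 1) + (A + p) * P      ≤⟨ +-monoˡ-≤ ((A + p) * P) (subst (_≤ P) (+-comm 1 r) (m%n<n x P)) ⟩
        P + (A + p) * P            ≡⟨ cong (_* P) (+-comm 1 (A + p)) ⟩
        c * P                      ∎
        where
        lemma : ∀ y p Q → y + (p * Q + 1) ≡ y + Q * p + 1
        lemma = solve-∀
        lemma′ : ∀ r A P p → r + A * P + P * p + 1 ≡ r + 1 + (A + p) * P
        lemma′ = solve-∀
      y+Pq<cP : y + P * q < c * P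
      y+Pq<cP with m≤n⇒m<n∨m≡n y+Pq≤cP
      ... | inj₁ < = <
      ... | inj₂ ≡ = contradiction (begin-equality
        y                    ≡⟨ m+n∸n≡m y (q * P) ⟨
        y + q * P ∸ q * P    ≡⟨ cong (λ z → y + z ∸ q * P) (*-comm q P) ⟩
        y + P * q ∸ q * P    ≡⟨ cong (_∸ q * P) ≡ ⟩
        c * P ∸ q * P        ≡⟨ *-distribʳ-∸ P c q ⟨
        (c ∸ q) * P          ∎) (P∤tp (c ∸ q) (s≤s z≤n) 1+b<P)

    φ-farApart : ∀ {a b} → 1 ≤ Q → suc a < P → suc b < P → FarApart P Q a b → FarApart p q (φ a) (φ b)
    φ-farApart {a} {b} 1≤Q 1+a<P 1+b<P far with ≤-total a b
    ... | inj₁ a≤b = farApart-intro (φ-lower 1+a<P (proj₁ bounds)) (φ-upper 1+b<P (proj₂ bounds))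
      where
      bounds : Q + a ≤ b × b + Q ≤ a + P
      bounds = farApart-elim 1≤Q far a≤b
    ... | inj₂ b≤a = farApart-sym {p} {q} {φ b} (farApart-intro (φ-lower 1+b<P (proj₁ bounds)) (φ-upper 1+a<P (proj₂ bounds)))
      where
      bounds : Q + b ≤ a × a + Q ≤ b + P
      bounds = farApart-elim 1≤Q (farApart-sym {P} {Q} {a} far) b≤a

  /-+-* : ∀ a t d .{{_ : NonZero d}} → (a + t * d) / d ≡ a / d + t
  /-+-* a t d = trans (+-distrib-/-∣ʳ a (n∣m*n t)) (cong (a / d +_) (m*n/n≡m t d))

  divide-farApart≤ : ∀ {P Q a b} d .{{_ : NonZero d}} → 1 ≤ Q → a ≤ b →
                     FarApart (P * d) (Q * d) a b → FarApart P Q (a / d) (b / d)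
  divide-farApart≤ {P} {Q} {a} {b} d 1≤Q a≤b far = farApart-intro
    (*≤⇒≤/ d (begin
      (Q + a / d) * d      ≡⟨ *-distribʳ-+ d Q (a / d) ⟩
      Q * d + a / d * d    ≤⟨ +-monoʳ-≤ (Q * d) (m/n*n≤m a d) ⟩
      Q * d + a            ≤⟨ proj₁ bounds ⟩
      b                    ∎))
    (begin
      b / d + Q            ≡⟨ /-+-* b Q d ⟨
      (b + Q * d) / d      ≤⟨ /-monoˡ-≤ d (proj₂ bounds) ⟩
      (a + P * d) / d      ≡⟨ /-+-* a P d ⟩
      a / d + P            ∎)
    where
    open ≤-Reasoning
    bounds : Q * d + a ≤ b × b + Q * d ≤ a + P * d
    bounds = farApart-elim (≤-trans 1≤Q (m≤m*n Q d)) far a≤b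

  divide-farApart : ∀ {P Q a b} d .{{_ : NonZero d}} → 1 ≤ Q →
                    FarApart (P * d) (Q * d) a b → FarApart P Q (a / d) (b / d)
  divide-farApart d 1≤Q = farApart-wlog (_/ d) (divide-farApart≤ d 1≤Q)

  missingColour : ∀ {n P} → n < P → (c : Fin n → Fin P) → ∃ λ m → ∀ v → c v ≢ m
  missingColour {n} {P} n<P c with Finₚ.any? (λ m → Finₚ.all? (λ v → ¬? (c v Finₚ.≟ m)))
  ... | yes missing  = missing
  ... | no ¬missing  = contradiction (Finₚ.injective⇒≤ preimage-injective) (<⇒≱ n<P)
    where
    hit : ∀ m → ∃ λ v → c v ≡ m
    hit m with Finₚ.¬∀⟶∃¬ n _ (λ v → ¬? (c v Finₚ.≟ m)) (λ avoided → ¬missing (m , avoided))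
    ... | v , ¬≢ = v , decidable-stable (c v Finₚ.≟ m) ¬≢
    preimage-injective : Injective _≡_ _≡_ (proj₁ ∘ hit)
    preimage-injective {i} {j} e = trans (sym (proj₂ (hit i))) (trans (cong c e) (proj₂ (hit j)))

  Neighbour : ℕ → ℕ → ℕ → Set
  Neighbour P Q q = ∃ λ p → P * q ≡ p * Q + 1

  identity⇒neighbour : ∀ {P Q} → 1 ≤ P → 1 ≤ Q → Bézout.Identity 1 P Q → ∃ (Neighbour P Q)
  identity⇒neighbour {P} {Q} _ _ (Bézout.+- x y eq) = x , y , trans (*-comm P x) (trans (sym eq) (+-comm 1 (y * Q)))
  identity⇒neighbour {suc P′} {1} _ _ (Bézout.-+ x y eq) = 1 , P′ , lemma P′
    where
    lemma : ∀ P′ → suc P′ * 1 ≡ P′ * 1 + 1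
    lemma = solve-∀
  -- from 1 + xP = yQ: P · (Q − 1)x = ((Q − 1)y − 1)Q + 1
  identity⇒neighbour {P} {suc (suc Q′)} _ _ (Bézout.-+ x (suc y′) eq) =
    suc Q′ * x , y′ + Q′ * suc y′ , +-cancelʳ-≡ (suc (suc Q′)) _ _ (begin
      P * (suc Q′ * x) + suc (suc Q′)            ≡⟨ lemma P Q′ x ⟩
      suc Q′ * (1 + x * P) + 1                   ≡⟨ cong (λ z → suc Q′ * z + 1) eq ⟩
      suc Q′ * (suc y′ * suc (suc Q′)) + 1       ≡⟨ lemma′ y′ Q′ ⟨
      (y′ + Q′ * suc y′) * suc (suc Q′) + 1 + suc (suc Q′) ∎)
      where
      open ≡-Reasoning
      lemma : ∀ P Q′ x → P * (suc Q′ * x) + suc (suc Q′) ≡ suc Q′ * (1 + x * P) + 1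
      lemma = solve-∀
      lemma′ : ∀ y′ Q′ → (y′ + Q′ * suc y′) * suc (suc Q′) + 1 + suc (suc Q′) ≡ suc Q′ * (suc y′ * suc (suc Q′)) + 1
      lemma′ = solve-∀

  module _ {P Q : ℕ} (1≤P : 1 ≤ P) (1≤Q : 1 ≤ Q) where

    neighbour-reduce : ∀ q → Neighbour P Q q → ∃ λ q′ → 1 ≤ q′ × q′ ≤ Q × Neighbour P Q q′
    neighbour-reduce = <-rec _ λ q rec (p , Pq≡) → reduce q rec p Pq≡
      where
      reduce : ∀ q → (∀ {t} → t < q → Neighbour P Q t → ∃ λ q′ → 1 ≤ q′ × q′ ≤ Q × Neighbour P Q q′) →
               ∀ p → P * q ≡ p * Q + 1 → ∃ λ q′ → 1 ≤ q′ × q′ ≤ Q × Neighbour P Q q′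
      reduce q rec p Pq≡ with q ≤? Q
      ... | yes q≤Q with q
      ...   | zero  = contradiction (trans (sym (*-zeroʳ P)) (trans Pq≡ (+-comm (p * Q) 1))) 0≢1+n
      ...   | suc q₀ = suc q₀ , s≤s z≤n , q≤Q , p , Pq≡
      reduce q rec p Pq≡ | no q≰Q = rec t<q (p ∸ P , Pt≡)
        where
        open ≤-Reasoning
        t : ℕ
        t = q ∸ Q
        Q+t≡q : Q + t ≡ q
        Q+t≡q = m+[n∸m]≡n (<⇒≤ (≰⇒> q≰Q))
        t<q : t < q
        t<q = subst (t <_) Q+t≡q (+-monoˡ-≤ t 1≤Q)
        Pq≡PQ+Pt : P * q ≡ P * Q + P * t
        Pq≡PQ+Pt = trans (cong (P *_) (sym Q+t≡q)) (*-distribˡ-+ P Q t)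
        P≤p : P ≤ p
        P≤p = ≮⇒≥ λ p<P → <-irrefl (sym Pq≡) (begin-strict
          p * Q + 1        ≤⟨ +-monoʳ-≤ (p * Q) 1≤Q ⟩
          p * Q + Q        ≡⟨ +-comm (p * Q) Q ⟩
          suc p * Q        ≤⟨ *-monoˡ-≤ Q p<P ⟩
          P * Q            <⟨ m<m+n (P * Q) (*-mono-≤ 1≤P (m<n⇒0<n∸m (≰⇒> q≰Q))) ⟩
          P * Q + P * t    ≡⟨ Pq≡PQ+Pt ⟨
          P * q            ∎)
        Pt≡ : P * t ≡ (p ∸ P) * Q + 1
        Pt≡ = +-cancelˡ-≡ (P * Q) _ _ (begin-equality
          P * Q + P * t                ≡⟨ Pq≡PQ+Pt ⟨
          P * q                        ≡⟨ Pq≡ ⟩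
          p * Q + 1                    ≡⟨ cong (λ z → z * Q + 1) (m+[n∸m]≡n P≤p) ⟨
          (P + (p ∸ P)) * Q + 1        ≡⟨ lemma P (p ∸ P) Q ⟩
          P * Q + ((p ∸ P) * Q + 1)    ∎)
          where
          lemma : ∀ P s Q → (P + s) * Q + 1 ≡ P * Q + (s * Q + 1)
          lemma = solve-∀

    lowerNeighbour : Bézout.Identity 1 P Q → ∃ λ q → 1 ≤ q × q ≤ Q × Neighbour P Q q
    lowerNeighbour identity = neighbour-reduce _ (proj₂ (identity⇒neighbour 1≤P 1≤Q identity))

  neighbour-bounds : ∀ {k P Q q p} → 1 ≤ q → q ≤ Q → Q < P → P * q ≡ p * Q + 1 → P < k * Q →
                     p < P × q ≤ p × p < k * q
  neighbour-bounds {k} {P} {Q} {q} {p} 1≤q q≤Q Q<P neighbours P<kQ = p<P , q≤p , p<kq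
    where
    instance
      Q≢0 : NonZero Q
      Q≢0 = >-nonZero (≤-trans 1≤q q≤Q)
      q≢0 : NonZero q
      q≢0 = >-nonZero 1≤q
    open ≤-Reasoning
    pQ<Pq : p * Q < P * q
    pQ<Pq = subst (p * Q <_) (sym neighbours) (subst (_≤ p * Q + 1) (+-comm (p * Q) 1) ≤-refl)
    p<P : p < P
    p<P = *-cancelʳ-< Q p P (<-≤-trans pQ<Pq (*-monoʳ-≤ P q≤Q))
    q≤p : q ≤ p
    q≤p = *-cancelʳ-≤ q p Q (s≤s⁻¹ (begin
      suc (q * Q)   ≤⟨ *-monoʳ-< q Q<P ⟩
      q * P         ≡⟨ trans (trans (*-comm q P) neighbours) (+-comm (p * Q) 1) ⟩
      suc (p * Q)   ∎))
    p<kq : p < k * q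
    p<kq = *-cancelʳ-< Q p (k * q) (begin-strict
      p * Q         <⟨ pQ<Pq ⟩
      P * q         <⟨ *-monoˡ-< q P<kQ ⟩
      k * Q * q     ≡⟨ lemma k Q q ⟩
      k * q * Q     ∎)
      where
      lemma : ∀ k Q q → k * Q * q ≡ k * q * Q
      lemma = solve-∀

  hom→K-farey : ∀ {n P Q q p} (G : Graph n) → n < P → 1 ≤ Q → 1 ≤ p → P * q ≡ p * Q + 1 →
                Hom→K G P Q → Hom→K G p q
  hom→K-farey {n} {P} {Q} {q} {p} G n<P 1≤Q 1≤p neighbours (c , hom) =
    hom→K-fromℕ G (φ ∘ rotated) (φ-< ∘ 1+rotated<P) λ u v uv →
      φ-farApart 1≤Q (1+rotated<P u) (1+rotated<P v) (rotate-farApart 1≤Q (hom u v uv))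
    where
    instance
      P≢0 : NonZero P
      P≢0 = >-nonZero (≤-<-trans z≤n n<P)
      p≢0 : NonZero p
      p≢0 = >-nonZero 1≤p
    -- rotate an unused colour m to the last position P − 1, which φ cannot handle
    m : Fin P
    m = proj₁ (missingColour n<P c)
    s : ℕ
    s = P ∸ suc (toℕ m)
    s+1+m≡P : s + suc (toℕ m) ≡ P
    s+1+m≡P = m∸n+n≡m (Finₚ.toℕ<n m)
    open Rotation P s (subst (s <_) s+1+m≡P (m<m+n s (s≤s z≤n)))
    open Farey {P} {p} {Q} {q} neighbours
    rotated : Fin n → ℕ
    rotated x = rotate (toℕ (c x))
    1+rotated<P : ∀ x → suc (rotated x) < P
    1+rotated<P x with m≤n⇒m<n∨m≡n (rotate-< (Finₚ.toℕ<n (c x)))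
    ... | inj₁ < = <
    ... | inj₂ ≡ = contradiction (Finₚ.toℕ-injective (rotate-onto-last s+1+m≡P (Finₚ.toℕ<n (c x)) ≡))
                                 (proj₂ (missingColour n<P c) x)

  module Shrinking (k : ℕ) {n : ℕ} (G : Graph n) where

    -- Admissible without the bound P ≤ n
    Colouring : ℕ → ℕ → Set
    Colouring P Q = Q ≤ P × Hom→K G P Q × P < k * Q

    colouring-divide : ∀ d {P Q} .{{_ : NonZero d}} → 1 ≤ Q → Colouring (P * d) (Q * d) → Colouring P Q
    colouring-divide d {P} {Q} 1≤Q (Qd≤Pd , (c , hom) , Pd<kQd) =
      *-cancelʳ-≤ Q P d Qd≤Pd ,
      hom→K-fromℕ G (λ x → toℕ (c x) / d) (λ x → m<n*o⇒m/o<n (Finₚ.toℕ<n (c x)))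
                  (λ u v uv → divide-farApart d 1≤Q (hom u v uv)) ,
      *-cancelʳ-< d P (k * Q) (subst (P * d <_) (sym (*-assoc k Q d)) Pd<kQd)

    colouring-farey : ∀ {P Q q p} → n < P → 1 ≤ q → q ≤ Q → Q < P → P * q ≡ p * Q + 1 →
                      Colouring P Q → p < P × Colouring p q
    colouring-farey {P} {Q} {q} {p} n<P 1≤q q≤Q Q<P neighbours (_ , hom , P<kQ)
      with neighbour-bounds {k} {P} {Q} {q} {p} 1≤q q≤Q Q<P neighbours P<kQ
    ... | p<P , q≤p , p<kq = p<P , q≤p , hom→K-farey G n<P (≤-trans 1≤q q≤Q) (≤-trans 1≤q q≤p) neighbours hom , p<kq

    ColouringBelow : ℕ → Set
    ColouringBelow P = ∃ λ q′ → Colouring P (suc q′)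

    shrink : ∀ {P} → 1 ≤ n → n < P → ColouringBelow P → ∃ λ P′ → P′ < P × ColouringBelow P′
    shrink {P} 1≤n n<P (q′ , colouring@(Q≤P , _ , _)) with Bézout.lemma P (suc q′)
    ... | Bézout.result 0 g _ = contradiction (0∣⇒≡0 (GCD.gcd∣m g)) (<⇒≢ (≤-<-trans z≤n n<P) ∘ sym)
    ... | Bézout.result 1 g identity with lowerNeighbour (≤-trans 1≤n (<⇒≤ n<P)) (s≤s z≤n) identity
    ...   | suc q₁ , 1≤q , q≤Q , p , neighbours = p , proj₁ farey , q₁ , proj₂ farey
      where
      Q<P : suc q′ < P
      Q<P with m≤n⇒m<n∨m≡n Q≤P
      ... | inj₁ Q<P = Q<P
      ... | inj₂ Q≡P = contradiction (∣⇒≤ (GCD.greatest g (∣-refl , subst (P ∣_) (sym Q≡P) ∣-refl))) (<⇒≱ (≤-<-trans 1≤n n<P))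
      farey : p < P × Colouring p (suc q₁)
      farey = colouring-farey n<P 1≤q q≤Q Q<P neighbours colouring
    shrink {P} 1≤n n<P (q′ , colouring) | Bézout.result d@(suc (suc _)) g _
      with GCD.gcd∣m g | GCD.gcd∣n g
    ... | divides (suc P₁) P≡ | divides (suc Q₁) Q≡ =
      suc P₁ , subst (suc P₁ <_) (sym P≡) (m<m*n (suc P₁) d (s≤s (s≤s z≤n))) ,
      Q₁ , colouring-divide d (s≤s z≤n) (subst₂ Colouring P≡ Q≡ colouring)
    ... | divides zero P≡ | _ = contradiction (trans P≡ refl) (<⇒≢ (≤-<-trans z≤n n<P) ∘ sym)

    colouringBelow⇒admissibleBelow : 1 ≤ n → ∀ P → ColouringBelow P → AdmissibleBelow k G
    colouringBelow⇒admissibleBelow 1≤n = <-rec _ λ P rec (q′ , Q≤P , hom , P<kQ) → decreasing P rec q′ Q≤P hom P<kQ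
      where
      decreasing : ∀ P → (∀ {P′} → P′ < P → ColouringBelow P′ → AdmissibleBelow k G) →
                   ∀ q′ → suc q′ ≤ P → Hom→K G P (suc q′) → P < k * suc q′ → AdmissibleBelow k G
      decreasing P rec q′ Q≤P hom P<kQ with P ≤? n
      ... | yes P≤n = P , q′ , (Q≤P , P≤n , hom) , P<kQ
      ... | no  P≰n with shrink 1≤n (≰⇒> P≰n) (q′ , Q≤P , hom , P<kQ)
      ...   | P′ , P′<P , smaller = rec P′<P smaller

  admitsHFree⇒admissibleBelow : ∀ k → 2 ≤ k → ∀ {n} → 1 ≤ n → (G : Graph n) → AdmitsHFree (suc k) G → AdmissibleBelow k G
  admitsHFree⇒admissibleBelow 1 (s≤s ()) _ _ _
  admitsHFree⇒admissibleBelow (suc (suc ℓ)) _ {suc n′} 1≤n G (C , isC , free) =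
    colouringBelow⇒admissibleBelow 1≤n P (suc (top + n * k) , N≤P , colouring , P<kN)
    where
    open OrderColouring ℓ G isC
    open WithoutSP (HFree⇒¬SP→ (suc k) X free)
    open Shrinking k G

  p<kq⇒p/q<k : ∀ k p q′ → p < k * suc q′ → ℤ.+ p ℚᵘ./ suc q′ ℚᵘ.< ℤ.+ k ℚᵘ./ 1
  p<kq⇒p/q<k k p q′ h =
    *<* (subst₂ ℤ._<_ (sym (ℤₚ.*-identityʳ (ℤ.+ p))) (ℤₚ.pos-* k (suc q′)) (ℤ.+<+ h))

  p≮kq⇒k≤p/q : ∀ k p q′ → ¬ p < k * suc q′ → ℤ.+ k ℚᵘ./ 1 ℚᵘ.≤ ℤ.+ p ℚᵘ./ suc q′
  p≮kq⇒k≤p/q k p q′ h =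
    *≤* (subst₂ ℤ._≤_ (ℤₚ.pos-* k (suc q′)) (sym (ℤₚ.*-identityʳ (ℤ.+ p))) (ℤ.+≤+ (≮⇒≥ h)))

  ∃-function? : ∀ n {m} (P : (Fin n → Fin m) → Set) →
                (∀ {f g} → (∀ i → f i ≡ g i) → P f → P g) → (∀ f → Dec (P f)) → Dec (∃ P)
  ∃-function? zero {m} P resp P? = map′ (empty ,_) (λ (f , p) → resp (λ ()) p) (P? empty)
    where
    empty : Fin 0 → Fin m
    empty ()
  ∃-function? (suc n) P resp P? =
    map′ (λ (a , f , p) → a ∷ f , p)
         (λ (f , p) → f F.zero , f ∘ F.suc , resp (λ { F.zero → refl ; (F.suc i) → refl }) p)
         (Finₚ.any? λ a → ∃-function? n (P ∘ (a ∷_))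
                            (λ e → resp λ { F.zero → refl ; (F.suc i) → e i }) (P? ∘ (a ∷_)))

  hom→K? : ∀ {n} (G : Graph n) p q → Dec (Hom→K G p q)
  hom→K? {n} G p q = ∃-function? n _
    (λ e hom u v uv → subst₂ (KAdj p q) (e u) (e v) (hom u v uv))
    (λ c → Finₚ.all? λ u → Finₚ.all? λ v →
             (Graph.adj G u v Boolₚ.≟ true) →-dec (q ≤? _))

  admissibleBelow? : ∀ k {n} (G : Graph n) → Dec (AdmissibleBelow k G)
  admissibleBelow? k {n} G =
    map′ (λ (p , _ , q′ , _ , h) → p , q′ , h)
         (λ (p , q′ , h@((q<p , p≤n , _) , _)) → p , s≤s p≤n , q′ , q<p , h)
         (anyUpTo? (λ p → anyUpTo? (λ q′ → admissible? p q′ ×-dec (p <? k * suc q′)) p) (suc n))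
    where
    admissible? : ∀ p q′ → Dec (Admissible G p q′)
    admissible? p q′ = (suc q′ ≤? p) ×-dec (p ≤? n) ×-dec hom→K? G p (suc q′)


open CircularColourings
  using (admissibleBelow?; admissibleBelow⇒admitsHFree; admitsHFree⇒admissibleBelow; p<kq⇒p/q<k; p≮kq⇒k≤p/q)
open import Data.Nat using (ℕ; _≤_; suc)
open import Data.Integer using (+_)
open import Data.Rational.Unnormalised using (ℚᵘ; _/_; _<_)
import Data.Rational.Unnormalised.Properties as ℚᵘₚ
open import Data.Product using (_×_; _,_)
open import Relation.Nullary using (yes; no; contradiction)

mainTheorem2 : (k : ℕ) → 2 ≤ k → (n : ℕ) → 1 ≤ n → (G : Graph n) →
               (r : ℚᵘ) → IsChiC G r →
               ((r < (+ k) / 1 → AdmitsHFree (ℕ.suc k) G)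
                × (AdmitsHFree (ℕ.suc k) G → r < (+ k) / 1))
mainTheorem2 k 2≤k n 1≤n G r (lowerBound , greatest) = forward , backward
  where
  forward : r < (+ k) / 1 → AdmitsHFree (suc k) G
  forward r<k with admissibleBelow? k G
  ... | yes below = admissibleBelow⇒admitsHFree k 2≤k G below
  ... | no ¬below = contradiction (greatest _ λ p q′ admissible →
                      p≮kq⇒k≤p/q k p q′ λ p<kq → ¬below (p , q′ , admissible , p<kq)) (ℚᵘₚ.<⇒≱ r<k)
  backward : AdmitsHFree (suc k) G → r < (+ k) / 1
  backward free with admitsHFree⇒admissibleBelow k 2≤k 1≤n G free
  ... | p , q′ , admissible , p<kq = ℚᵘₚ.≤-<-trans (lowerBound p q′ admissible) (p<kq⇒p/q<k k p q′ p<kq)
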